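{- Let $p$ be a function on graphs of the form $p(G)=\sum_H c_H\, H(G)$, a finite linear combination with complex coefficients $c_H$ over isomorphism types $H$ of graphs. Then $p$ is additive, i.e. $p(G_1\uplus G_2)=p(G_1)+p(G_2)$ for all graphs $G_1,G_2$ (disjoint union), if and only if $c_H=0$ for every non-connected $H$, i.e. $p$ is a finite linear combination of functions $H(\cdot)$ with $H$ connected.
   Context: All graphs are finite simple graphs; connected graphs are assumed to have at least one vertex (so the empty graph is not connected). For graphs $H,G$, $H(G)$ denotes the number of (not necessarily induced) subgraphs of $G$ isomorphic to $H$. The functions $G\mapsto H(G)$, for $H$ ranging over isomorphism types, are linearly independent, so the coefficients $c_H$ are uniquely determined by $p$. -}

module Defs where

open import Level using (Level)
open import Data.Bool using (Bool; true; false; _∧_; _∨_; not; if_then_else_)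
import Data.Bool.Properties as BoolP
open import Data.Nat using (ℕ; zero; suc; _<_)
import Data.Nat as ℕ
open import Data.Fin using (Fin; splitAt; _≟_)
open import Data.Sum using (_⊎_; inj₁; inj₂)
open import Data.Product using (_×_; _,_)
open import Data.List using (List; []; _∷_; map; filterᵇ; length; allFin; concatMap; deduplicate; foldr)
open import Data.Bool.ListAction using (any; all)
open import Data.Vec using (Vec; []; _∷_; lookup; tabulate)
import Data.Vec.Properties as VecP
open import Relation.Nullary using (¬_; does)
open import Relation.Binary.PropositionalEquality using (_≡_; refl)
open import Relation.Binary.Definitions using (DecidableEquality)
open import Algebra.Bundles using (CommutativeRing)

record Graph : Set where
  constructor mkGraph
  field
    n     : ℕ
    adj   : Fin n → Fin n → Bool
    sym   : ∀ u v → adj u v ≡ adj v u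
    irref : ∀ u → adj u u ≡ false
open Graph public

private
  ⊎adj : ∀ {a b} → (Fin a → Fin a → Bool) → (Fin b → Fin b → Bool) →
         Fin a ⊎ Fin b → Fin a ⊎ Fin b → Bool
  ⊎adj f g (inj₁ x) (inj₁ y) = f x y
  ⊎adj f g (inj₂ x) (inj₂ y) = g x y
  ⊎adj f g (inj₁ x) (inj₂ y) = false
  ⊎adj f g (inj₂ x) (inj₁ y) = false

  ⊎sym : ∀ {a b} (f : Fin a → Fin a → Bool) (g : Fin b → Fin b → Bool) →
         (∀ u v → f u v ≡ f v u) → (∀ u v → g u v ≡ g v u) →
         ∀ x y → ⊎adj f g x y ≡ ⊎adj f g y x
  ⊎sym f g sf sg (inj₁ x) (inj₁ y) = sf x y
  ⊎sym f g sf sg (inj₂ x) (inj₂ y) = sg x y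
  ⊎sym f g sf sg (inj₁ x) (inj₂ y) = refl
  ⊎sym f g sf sg (inj₂ x) (inj₁ y) = refl

  ⊎irr : ∀ {a b} (f : Fin a → Fin a → Bool) (g : Fin b → Fin b → Bool) →
         (∀ u → f u u ≡ false) → (∀ u → g u u ≡ false) →
         ∀ x → ⊎adj f g x x ≡ false
  ⊎irr f g rf rg (inj₁ x) = rf x
  ⊎irr f g rf rg (inj₂ x) = rg x

infixr 5 _⊎ᴳ_
_⊎ᴳ_ : Graph → Graph → Graph
G₁ ⊎ᴳ G₂ = mkGraph (n G₁ ℕ.+ n G₂)
  (λ x y → ⊎adj (adj G₁) (adj G₂) (splitAt (n G₁) x) (splitAt (n G₁) y))
  (λ x y → ⊎sym (adj G₁) (adj G₂) (sym G₁) (sym G₂) (splitAt (n G₁) x) (splitAt (n G₁) y))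
  (λ x → ⊎irr (adj G₁) (adj G₂) (irref G₁) (irref G₂) (splitAt (n G₁) x))

data Walk (G : Graph) : Fin (n G) → Fin (n G) → Set where
  here : ∀ {u} → Walk G u u
  step : ∀ {u w v} → adj G u w ≡ true → Walk G w v → Walk G u v

Connected : Graph → Set
Connected G = (0 < n G) × (∀ u v → Walk G u v)

allMaps : (m k : ℕ) → List (Vec (Fin k) m)
allMaps zero    k = [] ∷ []
allMaps (suc m) k = concatMap (λ x → map (x ∷_) (allMaps m k)) (allFin k)

private
  _==_ : ∀ {k} → Fin k → Fin k → Bool
  x == y = does (x ≟ y)

injectiveᵇ : ∀ {m k} → Vec (Fin k) m → Bool
injectiveᵇ {m} f = all (λ i → all (λ j → does (i ≟ j) ∨ not (lookup f i == lookup f j)) (allFin m)) (allFin m)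

embeddingᵇ : (H G : Graph) → Vec (Fin (n G)) (n H) → Bool
embeddingᵇ H G f = injectiveᵇ f ∧
  all (λ i → all (λ j → not (adj H i j) ∨ adj G (lookup f i) (lookup f j)) (allFin (n H))) (allFin (n H))

-- The subgraph of G that is the image of a map f : V(H) → V(G):
-- vertex set f(V(H)) and edge set f(E(H)).
Subgraph : ℕ → Set
Subgraph k = Vec Bool k × Vec (Vec Bool k) k

image : (H G : Graph) → Vec (Fin (n G)) (n H) → Subgraph (n G)
image H G f =
  tabulate (λ u → any (λ i → lookup f i == u) (allFin (n H))) ,
  tabulate (λ u → tabulate (λ v →
    any (λ i → any (λ j → (lookup f i == u) ∧ (lookup f j == v) ∧ adj H i j) (allFin (n H))) (allFin (n H))))

_≟Sub_ : ∀ {k} → DecidableEquality (Subgraph k)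
(a , b) ≟Sub (c , d) with VecP.≡-dec BoolP._≟_ a c | VecP.≡-dec (VecP.≡-dec BoolP._≟_) b d
... | Relation.Nullary.yes refl | Relation.Nullary.yes refl = Relation.Nullary.yes refl
... | Relation.Nullary.no p | _ = Relation.Nullary.no (λ { refl → p refl })
... | _ | Relation.Nullary.no q = Relation.Nullary.no (λ { refl → q refl })

-- H(G): the number of (not necessarily induced) subgraphs of G isomorphic
-- to H.  The subgraphs of G isomorphic to H are exactly the images of the
-- embeddings H ↪ G; we count the distinct ones.
count : Graph → Graph → ℕ
count H G = length (deduplicate _≟Sub_ (map (image H G) (filterᵇ (embeddingᵇ H G) (allMaps (n H) (n G)))))

isoᵇ : Graph → Graph → Bool
isoᵇ H K with Data.Nat._≟_ (n H) (n K)
... | Relation.Nullary.no _ = false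
... | Relation.Nullary.yes _ =
  any (λ f → injectiveᵇ f ∧
    all (λ i → all (λ j → does (BoolP._≟_ (adj H i j) (adj K (lookup f i) (lookup f j)))) (allFin (n H))) (allFin (n H)))
    (allMaps (n H) (n K))

module _ {c ℓ : Level} (R : CommutativeRing c ℓ) where
  open CommutativeRing R

  ℕ→R : ℕ → Carrier
  ℕ→R zero    = 0#
  ℕ→R (suc k) = 1# + ℕ→R k

  GraphPoly : Set c
  GraphPoly = List (Graph × Carrier)

  eval : GraphPoly → Graph → Carrier
  eval L G = foldr (λ { (H , a) acc → a * ℕ→R (count H G) + acc }) 0# L

  -- c_H: the coefficient of the isomorphism type of H in p
  -- (sum of the coefficients of all list entries isomorphic to H).
  coeff : GraphPoly → Graph → Carrier
  coeff L H = foldr (λ { (K , a) acc → (if isoᵇ K H then a else 0#) + acc }) 0# L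

  Additive : GraphPoly → Set ℓ
  Additive L = ∀ G₁ G₂ → eval L (G₁ ⊎ᴳ G₂) ≈ eval L G₁ + eval L G₂

module Submission where

-- (⇐) A connected K lies entirely inside one side of G₁ ⊎ G₂, so
-- K(G₁ ⊎ G₂) = K(G₁) + K(G₂); grouping p by isomorphism classes, every
-- class is connected (additive) or has coefficient 0.
--
-- (⇒) Induct on disconnected H, ordered by (vertices, edges).  If H is
-- empty, compare K₀ ⊎ K₀ with K₀, K₀; otherwise split H ≅ A ⊎ B with A, B
-- nonempty and compare A ⊎ B with A, B.  In the difference
-- p(A ⊎ B) − p(A) − p(B) = Σ_K c_K (K(A ⊎ B) − K(A) − K(B)) every class
-- other than that of H is connected (term 0), smaller than H (c_K = 0 by
-- induction) or does not embed into H (all counts 0; an embedding with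
-- equal vertex and at least as many edges is an isomorphism).  What
-- remains is c_H · (1 − 0 − 0), respectively c_H · (1 − 1 − 1), so c_H = 0.

open import Defs using (GraphPoly; Additive; Connected; coeff)
open import Level using (Level)
open import Relation.Nullary using (¬_)
open import Function.Bundles using (_⇔_; mk⇔)
open import Algebra.Bundles using (CommutativeRing)

module Combinatorics where

  open import Defs hiding (sym)
  open import Data.Bool using (Bool; true; false; _∧_; _∨_; not; T?)
  import Data.Bool.Properties as BoolP
  open import Data.Bool.Properties using (T-≡)
  open import Data.Bool.ListAction using (any; all)
  open import Data.Nat as ℕ using (ℕ; zero; suc; _+_; _≤_; _<_; z≤n; s≤s)
  import Data.Nat.Properties as ℕP
  open import Data.Fin using (Fin; zero; suc; _≟_; punchOut; splitAt; join; _↑ˡ_; _↑ʳ_; fromℕ<)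
  import Data.Fin.Properties as FinP
  open import Data.Product using (Σ; _×_; _,_; proj₁; proj₂; ∃-syntax)
  open import Data.Sum using (_⊎_; inj₁; inj₂; [_,_]′)
  open import Data.List using (List; []; _∷_; map; filterᵇ; length; allFin; deduplicate; _++_)
  open import Data.List.Properties using (length-++; length-map)
  open import Data.List.Relation.Unary.Any as Any using (here; there)
  open import Data.List.Membership.Propositional using (_∈_; _∉_)
  open import Data.List.Membership.Propositional.Properties
    using (∈-allFin; ∈-map⁺; ∈-map⁻; ∈-++⁺ˡ; ∈-++⁺ʳ; ∈-++⁻; ∈-concatMap⁺; ∈-filter⁺; ∈-filter⁻; ∈-deduplicate⁺; ∈-deduplicate⁻)
  open import Data.List.Membership.Propositional.Properties.WithK using (unique∧set⇒bag)
  open import Data.List.Relation.Binary.BagAndSetEquality using (∼bag⇒↭)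
  open import Data.List.Relation.Binary.Permutation.Propositional.Properties using (↭-length)
  open import Data.List.Relation.Binary.Permutation.Propositional.Properties.WithK using (dedup-++-↭)
  import Data.List.Relation.Unary.Unique.Propositional.Properties as Unique
  open import Data.List.Relation.Unary.Unique.DecPropositional.Properties using (deduplicate-!)
  open import Data.Vec using (Vec; []; _∷_; lookup; tabulate)
  open import Data.Vec.Properties using (lookup∘tabulate; tabulate-cong; tabulate∘lookup)
  open import Data.Vec.Functional using (Vector)
  open import Data.Fin.Permutation using (Permutation; permutation)
  open import Algebra.Properties.CommutativeMonoid.Sum ℕP.+-0-commutativeMonoid using (sum; sum-permute; sum-cong-≗)
  open import Data.Maybe using (Maybe; just; nothing; maybe)
  open import Data.Maybe.Properties using (just-injective)
  open import Data.Nat.Induction using (<-rec)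
  open import Data.Empty using (⊥; ⊥-elim)
  open import Function using (_∘_; id)
  open import Function.Bundles using (Equivalence; mk⇔)
  open import Relation.Nullary using (¬_; Dec; does; yes; no)
  open import Relation.Nullary.Decidable using (dec-true; dec-false; _×-dec_)
  open import Relation.Binary.Definitions using (DecidableEquality)
  open import Relation.Binary.PropositionalEquality using (_≡_; _≢_; refl; sym; trans; cong; cong₂; subst; module ≡-Reasoning)
  open ≡-Reasoning

  ∨-true : ∀ a b → a ∨ b ≡ true → a ≡ true ⊎ b ≡ true
  ∨-true true  b e = inj₁ refl
  ∨-true false b e = inj₂ e

  ∧-true : ∀ a b → a ∧ b ≡ true → a ≡ true × b ≡ true
  ∧-true true true e = refl , refl

  ∧-intro : ∀ {a b} → a ≡ true → b ≡ true → a ∧ b ≡ true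
  ∧-intro refl refl = refl

  ∨-introˡ : ∀ {a} b → a ≡ true → a ∨ b ≡ true
  ∨-introˡ b refl = refl

  ∨-introʳ : ∀ a {b} → b ≡ true → a ∨ b ≡ true
  ∨-introʳ true  e = refl
  ∨-introʳ false e = e

  bool-ext : ∀ {a b} → (a ≡ true → b ≡ true) → (b ≡ true → a ≡ true) → a ≡ b
  bool-ext {true}  {true}  f g = refl
  bool-ext {true}  {false} f g = sym (f refl)
  bool-ext {false} {true}  f g = g refl
  bool-ext {false} {false} f g = refl

  true≢false : true ≢ false
  true≢false ()

  not-true : ∀ {b} → not b ≡ true → b ≢ true
  not-true {true} () refl

  dec-sound : ∀ {a} {A : Set a} (d : Dec A) → does d ≡ true → A
  dec-sound (yes p) _ = p

  module _ {a} {A : Set a} where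

    any⇒∃ : ∀ (p : A → Bool) xs → any p xs ≡ true → ∃[ x ] (x ∈ xs × p x ≡ true)
    any⇒∃ p (x ∷ xs) e with ∨-true (p x) (any p xs) e
    ... | inj₁ px = x , here refl , px
    ... | inj₂ r with any⇒∃ p xs r
    ...   | y , y∈ , py = y , there y∈ , py

    ∃⇒any : ∀ (p : A → Bool) {xs x} → x ∈ xs → p x ≡ true → any p xs ≡ true
    ∃⇒any p {x ∷ xs} (here refl) px = ∨-introˡ (any p xs) px
    ∃⇒any p {x ∷ xs} (there m)   px = ∨-introʳ (p x) (∃⇒any p m px)

    all⇒∀ : ∀ (p : A → Bool) {xs x} → all p xs ≡ true → x ∈ xs → p x ≡ true
    all⇒∀ p {x ∷ xs} e (here refl) = proj₁ (∧-true (p x) (all p xs) e)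
    all⇒∀ p {x ∷ xs} e (there m)   = all⇒∀ p (proj₂ (∧-true (p x) (all p xs) e)) m

    ∀⇒all : ∀ (p : A → Bool) xs → (∀ x → x ∈ xs → p x ≡ true) → all p xs ≡ true
    ∀⇒all p []       h = refl
    ∀⇒all p (x ∷ xs) h = ∧-intro (h x (here refl)) (∀⇒all p xs (λ y m → h y (there m)))

    any-cong : ∀ (p q : A → Bool) xs → (∀ x → p x ≡ q x) → any p xs ≡ any q xs
    any-cong p q []       h = refl
    any-cong p q (x ∷ xs) h = cong₂ _∨_ (h x) (any-cong p q xs h)

    any-false : ∀ (p : A → Bool) xs → (∀ x → p x ≡ false) → any p xs ≡ false
    any-false p []       h = refl
    any-false p (x ∷ xs) h rewrite h x = any-false p xs h

    ∈-filterᵇ⁻ : ∀ (p : A → Bool) {x xs} → x ∈ filterᵇ p xs → x ∈ xs × p x ≡ true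
    ∈-filterᵇ⁻ p {xs = xs} m with ∈-filter⁻ (T? ∘ p) {xs = xs} m
    ... | x∈ , px = x∈ , Equivalence.to T-≡ px

    ∈-filterᵇ⁺ : ∀ (p : A → Bool) {x xs} → x ∈ xs → p x ≡ true → x ∈ filterᵇ p xs
    ∈-filterᵇ⁺ p m px = ∈-filter⁺ (T? ∘ p) m (Equivalence.from T-≡ px)

  vec-ext : ∀ {a} {A : Set a} {k} (xs ys : Vec A k) → (∀ i → lookup xs i ≡ lookup ys i) → xs ≡ ys
  vec-ext xs ys h = trans (sym (tabulate∘lookup xs)) (trans (tabulate-cong h) (tabulate∘lookup ys))

  anyFin⇒∃ : ∀ {n} (p : Fin n → Bool) → any p (allFin n) ≡ true → ∃[ i ] p i ≡ true
  anyFin⇒∃ p e with any⇒∃ p (allFin _) e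
  ... | i , _ , pi = i , pi

  ∃⇒anyFin : ∀ {n} (p : Fin n → Bool) i → p i ≡ true → any p (allFin n) ≡ true
  ∃⇒anyFin p i pi = ∃⇒any p (∈-allFin i) pi

  allFin⇒∀ : ∀ {n} (p : Fin n → Bool) → all p (allFin n) ≡ true → ∀ i → p i ≡ true
  allFin⇒∀ p e i = all⇒∀ p e (∈-allFin i)

  ∀⇒allFin : ∀ {n} (p : Fin n → Bool) → (∀ i → p i ≡ true) → all p (allFin n) ≡ true
  ∀⇒allFin p h = ∀⇒all p (allFin _) (λ i _ → h i)

  allMaps-complete : ∀ m k (v : Vec (Fin k) m) → v ∈ allMaps m k
  allMaps-complete zero    k []      = here refl
  allMaps-complete (suc m) k (x ∷ v) =
    ∈-concatMap⁺ (λ y → map (y ∷_) (allMaps m k)) (Any.map (λ { refl → ∈-map⁺ (x ∷_) (allMaps-complete m k v) }) (∈-allFin x))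

  Inj : ∀ {a b} → (Fin a → Fin b) → Set
  Inj f = ∀ i j → f i ≡ f j → i ≡ j

  Hom : (H G : Graph) → (Fin (n H) → Fin (n G)) → Set
  Hom H G f = ∀ i j → adj H i j ≡ true → adj G (f i) (f j) ≡ true

  Emb : (H G : Graph) → (Fin (n H) → Fin (n G)) → Set
  Emb H G f = Inj f × Hom H G f

  injectiveᵇ-sound : ∀ {m k} (v : Vec (Fin k) m) → injectiveᵇ v ≡ true → Inj (lookup v)
  injectiveᵇ-sound v e i j eq with i ≟ j | allFin⇒∀ _ (allFin⇒∀ _ e i) j
  ... | yes p | _ = p
  ... | no _  | r = ⊥-elim (not-true r (dec-true (lookup v i ≟ lookup v j) eq))

  injectiveᵇ-complete : ∀ {m k} (v : Vec (Fin k) m) → Inj (lookup v) → injectiveᵇ v ≡ true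
  injectiveᵇ-complete v h = ∀⇒allFin _ (λ i → ∀⇒allFin _ (λ j → pair i j))
    where
    pair : ∀ i j → does (i ≟ j) ∨ not (does (lookup v i ≟ lookup v j)) ≡ true
    pair i j with i ≟ j
    ... | yes _ = refl
    ... | no i≢j rewrite dec-false (lookup v i ≟ lookup v j) (λ q → i≢j (h i j q)) = refl

  homᵇ : (H G : Graph) → Vec (Fin (n G)) (n H) → Bool
  homᵇ H G v = all (λ i → all (λ j → not (adj H i j) ∨ adj G (lookup v i) (lookup v j)) (allFin (n H))) (allFin (n H))

  homᵇ-sound : ∀ H G v → homᵇ H G v ≡ true → Hom H G (lookup v)
  homᵇ-sound H G v e i j a with allFin⇒∀ _ (allFin⇒∀ _ e i) j
  ... | r rewrite a = r

  homᵇ-complete : ∀ H G v → Hom H G (lookup v) → homᵇ H G v ≡ true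
  homᵇ-complete H G v h = ∀⇒allFin _ (λ i → ∀⇒allFin _ (λ j → pair i j))
    where
    pair : ∀ i j → not (adj H i j) ∨ adj G (lookup v i) (lookup v j) ≡ true
    pair i j with adj H i j in eq
    ... | true  = h i j eq
    ... | false = refl

  embeddingᵇ-sound : ∀ H G v → embeddingᵇ H G v ≡ true → Emb H G (lookup v)
  embeddingᵇ-sound H G v e with ∧-true (injectiveᵇ v) (homᵇ H G v) e
  ... | i , h = injectiveᵇ-sound v i , homᵇ-sound H G v h

  embeddingᵇ-complete : ∀ H G v → Emb H G (lookup v) → embeddingᵇ H G v ≡ true
  embeddingᵇ-complete H G v (i , h) = ∧-intro (injectiveᵇ-complete v i) (homᵇ-complete H G v h)

  VertexHit : ∀ {m k} → Vec (Fin k) m → Fin k → Set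
  VertexHit v u = ∃[ i ] lookup v i ≡ u

  EdgeHit : ∀ (H : Graph) {k} → Vec (Fin k) (n H) → Fin k → Fin k → Set
  EdgeHit H v u w = ∃[ i ] ∃[ j ] (lookup v i ≡ u × lookup v j ≡ w × adj H i j ≡ true)

  vertexᵇ : ∀ {m k} → Vec (Fin k) m → Fin k → Bool
  vertexᵇ {m} v u = any (λ i → does (lookup v i ≟ u)) (allFin m)

  edgeᵇ : ∀ H {k} → Vec (Fin k) (n H) → Fin k → Fin k → Bool
  edgeᵇ H v u w = any (λ i → any (λ j → does (lookup v i ≟ u) ∧ does (lookup v j ≟ w) ∧ adj H i j)
                                 (allFin (n H))) (allFin (n H))

  vertexᵇ-sound : ∀ {m k} (v : Vec (Fin k) m) u → vertexᵇ v u ≡ true → VertexHit v u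
  vertexᵇ-sound v u e with anyFin⇒∃ _ e
  ... | i , p = i , dec-sound (lookup v i ≟ u) p

  vertexᵇ-complete : ∀ {m k} (v : Vec (Fin k) m) u → VertexHit v u → vertexᵇ v u ≡ true
  vertexᵇ-complete v u (i , p) = ∃⇒anyFin _ i (dec-true (lookup v i ≟ u) p)

  edgeᵇ-sound : ∀ H {k} (v : Vec (Fin k) (n H)) u w → edgeᵇ H v u w ≡ true → EdgeHit H v u w
  edgeᵇ-sound H v u w e with anyFin⇒∃ _ e
  ... | i , e′ with anyFin⇒∃ _ e′
  ... | j , e″ with ∧-true (does (lookup v i ≟ u)) _ e″
  ... | p , e‴ with ∧-true (does (lookup v j ≟ w)) _ e‴
  ... | q , r = i , j , dec-sound (lookup v i ≟ u) p , dec-sound (lookup v j ≟ w) q , r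

  edgeᵇ-complete : ∀ H {k} (v : Vec (Fin k) (n H)) u w → EdgeHit H v u w → edgeᵇ H v u w ≡ true
  edgeᵇ-complete H v u w (i , j , p , q , r) =
    ∃⇒anyFin _ i (∃⇒anyFin _ j (∧-intro (dec-true (lookup v i ≟ u) p) (∧-intro (dec-true (lookup v j ≟ w) q) r)))

  image-ext : ∀ H H′ G (v : Vec (Fin (n G)) (n H)) (w : Vec (Fin (n G)) (n H′)) →
    (∀ u → VertexHit v u → VertexHit w u) → (∀ u → VertexHit w u → VertexHit v u) →
    (∀ u x → EdgeHit H v u x → EdgeHit H′ w u x) → (∀ u x → EdgeHit H′ w u x → EdgeHit H v u x) →
    image H G v ≡ image H′ G w
  image-ext H H′ G v w f g f′ g′ = cong₂ _,_
    (tabulate-cong (λ u → bool-ext (λ e → vertexᵇ-complete w u (f u (vertexᵇ-sound v u e)))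
                                    (λ e → vertexᵇ-complete v u (g u (vertexᵇ-sound w u e)))))
    (tabulate-cong (λ u → tabulate-cong (λ x →
       bool-ext (λ e → edgeᵇ-complete H′ w u x (f′ u x (edgeᵇ-sound H v u x e)))
                (λ e → edgeᵇ-complete H v u x (g′ u x (edgeᵇ-sound H′ w u x e))))))

  module Card {a} {A : Set a} (_≟_ : DecidableEquality A) where

    card : List A → ℕ
    card xs = length (deduplicate _≟_ xs)

    card-set : ∀ xs ys → (∀ x → x ∈ xs → x ∈ ys) → (∀ x → x ∈ ys → x ∈ xs) → card xs ≡ card ys
    card-set xs ys f g = ↭-length (∼bag⇒↭ (unique∧set⇒bag (deduplicate-! _≟_ xs) (deduplicate-! _≟_ ys)
      (mk⇔ (λ m → ∈-deduplicate⁺ _≟_ (f _ (∈-deduplicate⁻ _≟_ xs m)))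
           (λ m → ∈-deduplicate⁺ _≟_ (g _ (∈-deduplicate⁻ _≟_ ys m))))))

    card-++ : ∀ xs ys → (∀ x → x ∈ xs → x ∈ ys → ⊥) → card (xs ++ ys) ≡ card xs + card ys
    card-++ xs ys d = trans (↭-length (dedup-++-↭ _≟_ (λ (p , q) → d _ p q))) (length-++ (deduplicate _≟_ xs))

    card-empty : ∀ xs → (∀ x → x ∉ xs) → card xs ≡ 0
    card-empty []       h = refl
    card-empty (x ∷ xs) h = ⊥-elim (h x (here refl))

    card-single : ∀ xs s → s ∈ xs → (∀ x → x ∈ xs → x ≡ s) → card xs ≡ 1
    card-single xs s m h = card-set xs (s ∷ []) (λ x mx → here (h x mx)) (λ { x (here refl) → m })

  open Card using (card; card-set; card-++; card-empty; card-single)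

  card-map : ∀ {a b} {A : Set a} {B : Set b} (_≟A_ : DecidableEquality A) (_≟B_ : DecidableEquality B)
             (g : A → B) → (∀ {x y} → g x ≡ g y → x ≡ y) → ∀ xs → card _≟B_ (map g xs) ≡ card _≟A_ xs
  card-map _≟A_ _≟B_ g g-inj xs = trans
    (↭-length (∼bag⇒↭ (unique∧set⇒bag (deduplicate-! _≟B_ (map g xs)) (Unique.map⁺ g-inj (deduplicate-! _≟A_ xs))
      (mk⇔ (λ m → fwd (∈-deduplicate⁻ _≟B_ (map g xs) m)) bwd))))
    (length-map g (deduplicate _≟A_ xs))
    where
    fwd : ∀ {y} → y ∈ map g xs → y ∈ map g (deduplicate _≟A_ xs)
    fwd m with ∈-map⁻ g m
    ... | x , mx , refl = ∈-map⁺ g (∈-deduplicate⁺ _≟A_ mx)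
    bwd : ∀ {y} → y ∈ map g (deduplicate _≟A_ xs) → y ∈ deduplicate _≟B_ (map g xs)
    bwd m with ∈-map⁻ g m
    ... | x , mx , refl = ∈-deduplicate⁺ _≟B_ (∈-map⁺ g (∈-deduplicate⁻ _≟A_ xs mx))

  images : (K G : Graph) → List (Subgraph (n G))
  images K G = map (image K G) (filterᵇ (embeddingᵇ K G) (allMaps (n K) (n G)))

  images⁻ : ∀ K G {s} → s ∈ images K G → ∃[ v ] (Emb K G (lookup v) × image K G v ≡ s)
  images⁻ K G m with ∈-map⁻ (image K G) m
  ... | v , mv , refl with ∈-filterᵇ⁻ (embeddingᵇ K G) {xs = allMaps (n K) (n G)} mv
  ... | _ , e = v , embeddingᵇ-sound K G v e , refl

  images⁺ : ∀ K G v → Emb K G (lookup v) → image K G v ∈ images K G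
  images⁺ K G v e = ∈-map⁺ (image K G)
    (∈-filterᵇ⁺ (embeddingᵇ K G) (allMaps-complete _ _ v) (embeddingᵇ-complete K G v e))

  count-zero : ∀ K G → (∀ v → ¬ Emb K G (lookup v)) → count K G ≡ 0
  count-zero K G h = card-empty _≟Sub_ (images K G) (λ s m → let (v , e , _) = images⁻ K G m in h v e)

  count-one : ∀ K G v₀ → Emb K G (lookup v₀) → (∀ v → Emb K G (lookup v) → image K G v ≡ image K G v₀) →
              count K G ≡ 1
  count-one K G v₀ e₀ h = card-single _≟Sub_ (images K G) (image K G v₀) (images⁺ K G v₀ e₀)
    (λ s m → let (v , e , eq) = images⁻ K G m in trans (sym eq) (h v e))

  record Iso (K H : Graph) : Set where
    field
      to      : Fin (n K) → Fin (n H)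
      from    : Fin (n H) → Fin (n K)
      from-to : ∀ i → from (to i) ≡ i
      to-from : ∀ i → to (from i) ≡ i
      adj-to  : ∀ i j → adj K i j ≡ adj H (to i) (to j)
  open Iso

  Iso-refl : ∀ K → Iso K K
  Iso-refl K = record { to = id ; from = id ; from-to = λ _ → refl ; to-from = λ _ → refl ; adj-to = λ _ _ → refl }

  Iso-sym : ∀ {K H} → Iso K H → Iso H K
  Iso-sym {K} {H} I = record
    { to = from I ; from = to I ; from-to = to-from I ; to-from = from-to I
    ; adj-to = λ i j → trans (cong₂ (adj H) (sym (to-from I i)) (sym (to-from I j)))
                               (sym (adj-to I (from I i) (from I j))) }

  Iso-trans : ∀ {K H M} → Iso K H → Iso H M → Iso K M
  Iso-trans I J = record
    { to = to J ∘ to I ; from = from I ∘ from J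
    ; from-to = λ i → trans (cong (from I) (from-to J (to I i))) (from-to I i)
    ; to-from = λ i → trans (cong (to J) (to-from I (from J i))) (to-from J i)
    ; adj-to = λ i j → trans (adj-to I i j) (adj-to J (to I i) (to I j)) }

  Iso-n : ∀ {K H} → Iso K H → n K ≡ n H
  Iso-n I = FinP.cantor-schröder-bernstein {f = to I} {g = from I}
    (λ {i} {j} e → trans (sym (from-to I i)) (trans (cong (from I) e) (from-to I j)))
    (λ {i} {j} e → trans (sym (to-from I i)) (trans (cong (to I) e) (to-from I j)))

  Emb-Iso : ∀ {K G G′} (h : Fin (n K) → Fin (n G)) → Emb K G h → (I : Iso G G′) → Emb K G′ (to I ∘ h)
  Emb-Iso h (h-inj , h-hom) I =
    (λ i j e → h-inj i j (trans (sym (from-to I (h i))) (trans (cong (from I) e) (from-to I (h j))))) ,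
    (λ i j a → trans (sym (adj-to I (h i) (h j))) (h-hom i j a))

  -- Precomposing with the inverse of an isomorphism K ≅ K′ turns every
  -- embedding of K into an embedding of K′ with the same image; hence
  -- count K G depends only on the isomorphism type of K.
  images-iso-⊆ : ∀ {K K′} G → Iso K K′ → ∀ s → s ∈ images K G → s ∈ images K′ G
  images-iso-⊆ {K} {K′} G I s m with images⁻ K G m
  ... | v , (v-inj , v-hom) , refl = subst (_∈ images K′ G) (sym same-image) (images⁺ K′ G w (w-inj , w-hom))
    where
    w : Vec (Fin (n G)) (n K′)
    w = tabulate (lookup v ∘ from I)
    lw : ∀ i → lookup w i ≡ lookup v (from I i)
    lw = lookup∘tabulate (lookup v ∘ from I)
    lw-to : ∀ i → lookup w (to I i) ≡ lookup v i
    lw-to i = trans (lw (to I i)) (cong (lookup v) (from-to I i))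
    w-inj : Inj (lookup w)
    w-inj i j e = trans (sym (to-from I i))
      (trans (cong (to I) (v-inj _ _ (trans (sym (lw i)) (trans e (lw j))))) (to-from I j))
    w-hom : Hom K′ G (lookup w)
    w-hom i j a rewrite lw i | lw j =
      v-hom _ _ (trans (adj-to I (from I i) (from I j)) (trans (cong₂ (adj K′) (to-from I i) (to-from I j)) a))
    same-image : image K G v ≡ image K′ G w
    same-image = image-ext K K′ G v w
      (λ u (i , p) → to I i , trans (lw-to i) p)
      (λ u (i , p) → from I i , trans (sym (lw i)) p)
      (λ u x (i , j , p , q , r) → to I i , to I j , trans (lw-to i) p , trans (lw-to j) q , trans (sym (adj-to I i j)) r)
      (λ u x (i , j , p , q , r) → from I i , from I j , trans (sym (lw i)) p , trans (sym (lw j)) q ,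
          trans (adj-to I (from I i) (from I j)) (trans (cong₂ (adj K′) (to-from I i) (to-from I j)) r))

  count-iso : ∀ {K K′} G → Iso K K′ → count K G ≡ count K′ G
  count-iso G I = card-set _≟Sub_ _ _ (images-iso-⊆ G I) (images-iso-⊆ G (Iso-sym I))

  inj-size : ∀ {m k} (h : Fin m → Fin k) → Inj h → m ≤ k
  inj-size h h-inj = FinP.injective⇒≤ {f = h} (λ {i} {j} → h-inj i j)

  inj-surj : ∀ {m k} (h : Fin m → Fin k) → Inj h → m ≡ k → ∀ y → ∃[ i ] h i ≡ y
  inj-surj {m} {suc k} h h-inj m≡1+k y with FinP.any? (λ i → h i ≟ y)
  ... | yes hit = hit
  ... | no miss = ⊥-elim (ℕP.<-irrefl refl (subst (_≤ k) m≡1+k (inj-size h′ h′-inj)))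
    where
    -- h misses y, so it factors injectively through Fin k.
    h′ : Fin m → Fin k
    h′ i = punchOut (λ e → miss (i , sym e))
    h′-inj : Inj h′
    h′-inj i j e = h-inj i j (FinP.punchOut-injective (λ e → miss (i , sym e)) (λ e → miss (j , sym e)) e)

  module Inverse {m k} (h : Fin m → Fin k) (h-inj : Inj h) (m≡k : m ≡ k) where
    inv : Fin k → Fin m
    inv y = proj₁ (inj-surj h h-inj m≡k y)
    h-inv : ∀ y → h (inv y) ≡ y
    h-inv y = proj₂ (inj-surj h h-inj m≡k y)
    inv-h : ∀ i → inv (h i) ≡ i
    inv-h i = h-inj _ _ (h-inv (h i))
    permutation′ : Permutation m k
    permutation′ = permutation h inv h-inv inv-h

  -- isoᵇ decides isomorphism; in particular it is an equivalence
  -- relation, which is what the coefficient extraction c_H relies on.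

  isoᵇ-sound : ∀ K H → isoᵇ K H ≡ true → Iso K H
  isoᵇ-sound K H e with ℕ._≟_ (n K) (n H)
  ... | yes nK≡nH with any⇒∃ _ (allMaps (n K) (n H)) e
  ... | v , _ , pv with ∧-true (injectiveᵇ v) _ pv
  ... | v-injᵇ , v-adjᵇ = record
    { to = lookup v ; from = inv ; from-to = inv-h ; to-from = h-inv
    ; adj-to = λ i j → dec-sound (BoolP._≟_ (adj K i j) (adj H (lookup v i) (lookup v j)))
                                  (allFin⇒∀ _ (allFin⇒∀ _ v-adjᵇ i) j) }
    where open Inverse (lookup v) (injectiveᵇ-sound v v-injᵇ) nK≡nH

  isoᵇ-complete : ∀ K H → Iso K H → isoᵇ K H ≡ true
  isoᵇ-complete K H I with ℕ._≟_ (n K) (n H)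
  ... | no nK≢nH = ⊥-elim (nK≢nH (Iso-n I))
  ... | yes _ = ∃⇒any _ (allMaps-complete (n K) (n H) v) (∧-intro (injectiveᵇ-complete v v-inj)
      (∀⇒allFin _ (λ i → ∀⇒allFin _ (λ j → dec-true (BoolP._≟_ (adj K i j) (adj H (lookup v i) (lookup v j)))
         (trans (adj-to I i j) (sym (cong₂ (adj H) (lv i) (lv j))))))))
    where
    v : Vec (Fin (n H)) (n K)
    v = tabulate (to I)
    lv : ∀ i → lookup v i ≡ to I i
    lv = lookup∘tabulate (to I)
    v-inj : Inj (lookup v)
    v-inj i j e = trans (sym (from-to I i)) (trans (cong (from I) (trans (sym (lv i)) (trans e (lv j)))) (from-to I j))

  isoᵇ-refl : ∀ K → isoᵇ K K ≡ true
  isoᵇ-refl K = isoᵇ-complete K K (Iso-refl K)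

  isoᵇ-sym : ∀ K H → isoᵇ K H ≡ true → isoᵇ H K ≡ true
  isoᵇ-sym K H e = isoᵇ-complete H K (Iso-sym (isoᵇ-sound K H e))

  isoᵇ-trans : ∀ K H M → isoᵇ K H ≡ true → isoᵇ H M ≡ true → isoᵇ K M ≡ true
  isoᵇ-trans K H M e e′ = isoᵇ-complete K M (Iso-trans (isoᵇ-sound K H e) (isoᵇ-sound H M e′))

  isoᵇ-false : ∀ {K H} → isoᵇ K H ≡ false → ¬ Iso K H
  isoᵇ-false {K} {H} K≇H I = true≢false (trans (sym (isoᵇ-complete K H I)) K≇H)

  -- An embedding K ↪ G between graphs with the same number
  -- of vertices and edges G ≤ edges K is an isomorphism: it is a
  -- bijection on vertices, and an edge-preserving bijection cannot
  -- create non-edges when the edge totals allow no room.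

  b2n : Bool → ℕ
  b2n true  = 1
  b2n false = 0

  b2n-mono : ∀ {a b} → (a ≡ true → b ≡ true) → b2n a ≤ b2n b
  b2n-mono {false} h = z≤n
  b2n-mono {true}  h rewrite h refl = s≤s z≤n

  b2n-inj : ∀ {a b} → b2n a ≡ b2n b → a ≡ b
  b2n-inj {true}  {true}  e = refl
  b2n-inj {false} {false} e = refl

  -- Number of ordered adjacent pairs (twice the number of edges).
  edges : Graph → ℕ
  edges G = sum (λ i → sum (λ j → b2n (adj G i j)))

  sum-mono : ∀ {m} (a b : Vector ℕ m) → (∀ i → a i ≤ b i) → sum a ≤ sum b
  sum-mono {zero}  a b h = z≤n
  sum-mono {suc m} a b h = ℕP.+-mono-≤ (h zero) (sum-mono (a ∘ suc) (b ∘ suc) (h ∘ suc))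

  sum-tight : ∀ {m} (a b : Vector ℕ m) → (∀ i → a i ≤ b i) → sum b ≤ sum a → ∀ i → a i ≡ b i
  sum-tight {suc m} a b h le = tight
    where
    head≡ : a zero ≡ b zero
    head≡ = ℕP.≤-antisym (h zero) (ℕP.+-cancelʳ-≤ (sum (b ∘ suc)) (b zero) (a zero)
             (ℕP.≤-trans le (ℕP.+-monoʳ-≤ (a zero) (sum-mono (a ∘ suc) (b ∘ suc) (h ∘ suc)))))
    tail≤ : sum (b ∘ suc) ≤ sum (a ∘ suc)
    tail≤ = ℕP.+-cancelˡ-≤ (a zero) (sum (b ∘ suc)) (sum (a ∘ suc))
              (subst (λ z → z + sum (b ∘ suc) ≤ a zero + sum (a ∘ suc)) (sym head≡) le)
    tight : ∀ i → a i ≡ b i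
    tight zero    = head≡
    tight (suc i) = sum-tight (a ∘ suc) (b ∘ suc) (h ∘ suc) tail≤ i

  emb-iso : ∀ K G (h : Fin (n K) → Fin (n G)) → Emb K G h → n K ≡ n G → edges G ≤ edges K → Iso K G
  emb-iso K G h (h-inj , h-hom) nK≡nG le = record
    { to = h ; from = inv ; from-to = inv-h ; to-from = h-inv ; adj-to = λ i j → b2n-inj (row≡ i j) }
    where
    open Inverse h h-inj nK≡nG
    A C : Fin (n K) → Fin (n K) → ℕ
    A i j = b2n (adj K i j)
    C i j = b2n (adj G (h i) (h j))
    A≤C : ∀ i j → A i j ≤ C i j
    A≤C i j = b2n-mono (h-hom i j)
    -- Reindexing the double sum of G along the bijection h.
    edgesG : edges G ≡ sum (λ i → sum (C i))
    edgesG = trans (sum-permute (λ i → sum (λ j → b2n (adj G i j))) permutation′)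
                   (sum-cong-≗ (λ i → sum-permute (λ j → b2n (adj G (h i) j)) permutation′))
    rows≡ : ∀ i → sum (A i) ≡ sum (C i)
    rows≡ = sum-tight (λ i → sum (A i)) (λ i → sum (C i)) (λ i → sum-mono (A i) (C i) (A≤C i))
              (subst (_≤ edges K) edgesG le)
    row≡ : ∀ i j → A i j ≡ C i j
    row≡ i = sum-tight (A i) (C i) (A≤C i) (ℕP.≤-reflexive (sym (rows≡ i)))

  -- Every graph occurs exactly once in itself: all self-embeddings are
  -- automorphisms and so have the full image.
  count-self : ∀ G → count G G ≡ 1
  count-self G = count-one G G v₀ e₀ all-full
    where
    v₀ : Vec (Fin (n G)) (n G)
    v₀ = tabulate id
    lv₀ : ∀ i → lookup v₀ i ≡ i
    lv₀ = lookup∘tabulate id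
    e₀ : Emb G G (lookup v₀)
    e₀ = (λ i j e → trans (sym (lv₀ i)) (trans e (lv₀ j))) ,
         (λ i j a → subst (_≡ true) (sym (cong₂ (adj G) (lv₀ i) (lv₀ j))) a)
    all-full : ∀ v → Emb G G (lookup v) → image G G v ≡ image G G v₀
    all-full v e = image-ext G G G v v₀
      (λ u _ → u , lv₀ u)
      (λ u _ → from I u , to-from I u)
      (λ u x (i , j , p , q , r) → u , x , lv₀ u , lv₀ x , subst (_≡ true) (trans (adj-to I i j) (cong₂ (adj G) p q)) r)
      (λ u x (i , j , p , q , r) → from I i , from I j ,
          trans (to-from I i) (trans (sym (lv₀ i)) p) , trans (to-from I j) (trans (sym (lv₀ j)) q) ,
          subst (_≡ true) (sym (trans (adj-to I (from I i) (from I j)) (cong₂ (adj G) (to-from I i) (to-from I j)))) r)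
      where
      I : Iso G G
      I = emb-iso G G (lookup v) e refl ℕP.≤-refl

  -- The component of u is computed by growing
  -- {u} along edges until it is closed; the size of the set strictly
  -- increases at each step, so N steps suffice.  This makes
  -- connectedness decidable and exhibits, for a disconnected graph, a
  -- proper adjacency-closed vertex set.

  walk-snoc : ∀ {G u i j} → Walk G u i → adj G i j ≡ true → Walk G u j
  walk-snoc here       a = step a here
  walk-snoc (step b w) a = step b (walk-snoc w a)

  size : ∀ {N} → (Fin N → Bool) → ℕ
  size S = sum (λ i → b2n (S i))

  size≤ : ∀ {N} (S : Fin N → Bool) → size S ≤ N
  size≤ {zero}  S = z≤n
  size≤ {suc N} S = ℕP.+-mono-≤ (b2n≤1 (S zero)) (size≤ (S ∘ suc))
    where
    b2n≤1 : ∀ b → b2n b ≤ 1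
    b2n≤1 true  = s≤s z≤n
    b2n≤1 false = z≤n

  size-grow : ∀ {N} (S S′ : Fin N → Bool) → (∀ i → S i ≡ true → S′ i ≡ true) →
              ∀ j → S j ≡ false → S′ j ≡ true → size S < size S′
  size-grow S S′ S⊆S′ j Sj Sj′ = ℕP.≰⇒> (λ le → differ (sum-tight _ _ (λ i → b2n-mono (S⊆S′ i)) le j))
    where
    differ : b2n (S j) ≢ b2n (S′ j)
    differ e rewrite Sj | Sj′ with e
    ... | ()

  module Component (G : Graph) (u : Fin (n G)) where
    N : ℕ
    N = n G

    Reached : (Fin N → Bool) → Set
    Reached S = ∀ i → S i ≡ true → Walk G u i

    Closed : (Fin N → Bool) → Set
    Closed S = ∀ i j → S i ≡ true → adj G i j ≡ true → S j ≡ true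

    extend : (Fin N → Bool) → Fin N → Bool
    extend S j = S j ∨ any (λ i → S i ∧ adj G i j) (allFin N)

    extend-reached : ∀ S → Reached S → Reached (extend S)
    extend-reached S reached k e with ∨-true (S k) _ e
    ... | inj₁ Sk = reached k Sk
    ... | inj₂ r with anyFin⇒∃ _ r
    ... | i , r′ with ∧-true (S i) _ r′
    ... | Si , a = walk-snoc (reached i Si) a

    leaving-edge? : (S : Fin N → Bool) → Dec (∃[ i ] ∃[ j ] (S i ≡ true × adj G i j ≡ true × S j ≡ false))
    leaving-edge? S = FinP.any? (λ i → FinP.any? (λ j →
      BoolP._≟_ (S i) true ×-dec (BoolP._≟_ (adj G i j) true ×-dec BoolP._≟_ (S j) false)))

    Saturation : (Fin N → Bool) → Set
    Saturation S = Σ (Fin N → Bool) (λ S′ → Reached S′ × Closed S′ × (∀ i → S i ≡ true → S′ i ≡ true))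

    saturate : (fuel : ℕ) (S : Fin N → Bool) → Reached S → N < size S + fuel → Saturation S
    saturate fuel S reached bound with leaving-edge? S
    ... | no none = S , reached , closed , (λ i e → e)
      where
      closed : Closed S
      closed i j Si a with S j in eq
      ... | true  = refl
      ... | false = ⊥-elim (none (i , j , Si , a , eq))
    saturate zero S reached bound | yes _ =
      ⊥-elim (ℕP.<-irrefl refl (ℕP.<-≤-trans bound (subst (_≤ N) (sym (ℕP.+-identityʳ (size S))) (size≤ S))))
    saturate (suc fuel) S reached bound | yes (i , j , Si , a , Sj)
      with saturate fuel (extend S) (extend-reached S reached) bound′
      where
      grows : size S < size (extend S)
      grows = size-grow S (extend S) (λ k e → ∨-introˡ _ e) j Sj (∨-introʳ (S j) (∃⇒anyFin _ i (∧-intro Si a)))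
      bound′ : N < size (extend S) + fuel
      bound′ = ℕP.<-≤-trans bound (subst (_≤ size (extend S) + fuel) (sym (ℕP.+-suc (size S) fuel)) (ℕP.+-monoˡ-≤ fuel grows))
    ... | S′ , reached′ , closed′ , ⊆S′ = S′ , reached′ , closed′ , (λ k e → ⊆S′ k (∨-introˡ _ e))

    component : Saturation (λ j → does (u ≟ j))
    component = saturate (suc N) (λ j → does (u ≟ j)) (λ j e → subst (Walk G u) (dec-sound (u ≟ j) e) here)
                         (ℕP.<-≤-trans (ℕP.n<1+n N) (ℕP.m≤n+m (suc N) _))

    R : Fin N → Bool
    R = proj₁ component

    R-reached : Reached R
    R-reached = proj₁ (proj₂ component)

    R-closed : Closed R
    R-closed = proj₁ (proj₂ (proj₂ component))

    R-u : R u ≡ true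
    R-u = proj₂ (proj₂ (proj₂ component)) u (dec-true (u ≟ u) refl)

    R-complete : ∀ v → Walk G u v → R v ≡ true
    R-complete v w = along w R-u
      where
      along : ∀ {a b} → Walk G a b → R a ≡ true → R b ≡ true
      along here       e = e
      along (step a w) e = along w (R-closed _ _ e a)

  all-components? : ∀ G → Dec (∀ u v → Component.R G u v ≡ true)
  all-components? G = FinP.all? (λ u → FinP.all? (λ v → BoolP._≟_ (Component.R G u v) true))

  connected? : ∀ G → Dec (Connected G)
  connected? G with ℕ._<?_ 0 (n G)
  ... | no empty = no (λ c → empty (proj₁ c))
  ... | yes nonempty with all-components? G
  ... | yes full = yes (nonempty , λ u v → Component.R-reached G u v (full u v))
  ... | no ¬full = no (λ c → ¬full (λ u v → Component.R-complete G u v (proj₂ c u v)))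

  outside-component : ∀ G → ¬ Connected G → 0 < n G → ∃[ u ] ∃[ v ] Component.R G u v ≡ false
  outside-component G disconnected nonempty with all-components? G
  ... | yes full = ⊥-elim (disconnected (nonempty , λ u v → Component.R-reached G u v (full u v)))
  ... | no ¬full with FinP.¬∀⟶∃¬ _ _ (λ u → FinP.all? (λ v → BoolP._≟_ (Component.R G u v) true)) ¬full
  ... | u , ¬u with FinP.¬∀⟶∃¬ _ _ (λ v → BoolP._≟_ (Component.R G u v) true) ¬u
  ... | v , ¬v = u , v , BoolP.¬-not ¬v

  -- Let ι : G → G′ be an inclusion onto a set of
  -- vertices of G′ that is a union of components (edges of G′ at a
  -- vertex in the range stay in the range), with partial inverse π.
  -- Subgraphs of G transport injectively to subgraphs of G′ (T), and a
  -- connected K embeds into G′ meeting the range of ι iff it embeds into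
  -- G, with corresponding images.

  module ClosedInclusion (G G′ : Graph) (ι : Fin (n G) → Fin (n G′)) (π : Fin (n G′) → Maybe (Fin (n G)))
      (π-ι : ∀ a → π (ι a) ≡ just a) (ι-π : ∀ z a → π z ≡ just a → ι a ≡ z)
      (adj-ι : ∀ a b → adj G′ (ι a) (ι b) ≡ adj G a b)
      (closed : ∀ z z′ a → π z ≡ just a → adj G′ z z′ ≡ true → ∃[ a′ ] π z′ ≡ just a′) where

    ι-inj : Inj ι
    ι-inj a b e = just-injective (trans (sym (π-ι a)) (trans (cong π e) (π-ι b)))

    ≟-ι : ∀ x y → does (x ≟ y) ≡ does (ι x ≟ ι y)
    ≟-ι x y with x ≟ y
    ... | yes refl = sym (dec-true (ι x ≟ ι x) refl)
    ... | no x≢y  = sym (dec-false (ι x ≟ ι y) (λ e → x≢y (ι-inj x y e)))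

    ≟-outside : ∀ z → π z ≡ nothing → ∀ x → does (ι x ≟ z) ≡ false
    ≟-outside z e x = dec-false (ι x ≟ z) (λ q → just≢nothing (trans (sym (π-ι x)) (trans (cong π q) e)))
      where
      just≢nothing : just x ≢ nothing
      just≢nothing ()

    sel : (Fin (n G) → Bool) → Fin (n G′) → Bool
    sel h z = maybe h false (π z)

    sel-ι : ∀ h a → sel h (ι a) ≡ h a
    sel-ι h a rewrite π-ι a = refl

    T : Subgraph (n G) → Subgraph (n G′)
    T (vs , es) = tabulate (sel (lookup vs)) ,
                  tabulate (λ z → tabulate (λ z′ → sel (λ a → sel (λ a′ → lookup (lookup es a) a′) z′) z))

    T-vertex : ∀ s a → lookup (proj₁ (T s)) (ι a) ≡ lookup (proj₁ s) a
    T-vertex (vs , es) a = trans (lookup∘tabulate _ (ι a)) (sel-ι (lookup vs) a)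

    T-edge : ∀ s a a′ → lookup (lookup (proj₂ (T s)) (ι a)) (ι a′) ≡ lookup (lookup (proj₂ s) a) a′
    T-edge (vs , es) a a′
      rewrite lookup∘tabulate (λ z → tabulate (λ z′ → sel (λ a → sel (λ a′ → lookup (lookup es a) a′) z′) z)) (ι a)
            | lookup∘tabulate (λ z′ → sel (λ b → sel (λ a′ → lookup (lookup es b) a′) z′) (ι a)) (ι a′)
            | π-ι a | π-ι a′ = refl

    T-inj : ∀ {s s′} → T s ≡ T s′ → s ≡ s′
    T-inj {vs , es} {vs′ , es′} e = cong₂ _,_
      (vec-ext vs vs′ (λ a → trans (sym (T-vertex (vs , es) a))
        (trans (cong (λ s → lookup (proj₁ s) (ι a)) e) (T-vertex (vs′ , es′) a))))
      (vec-ext es es′ (λ a → vec-ext _ _ (λ a′ → trans (sym (T-edge (vs , es) a a′))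
        (trans (cong (λ s → lookup (lookup (proj₂ s) (ι a)) (ι a′)) e) (T-edge (vs′ , es′) a a′)))))

    lift : ∀ {k} → Vec (Fin (n G)) k → Vec (Fin (n G′)) k
    lift w = tabulate (ι ∘ lookup w)

    T-image : ∀ K (w : Vec (Fin (n G)) (n K)) → T (image K G w) ≡ image K G′ (lift w)
    T-image K w = cong₂ _,_ (tabulate-cong vertices) (tabulate-cong (λ z → tabulate-cong (edges′ z)))
      where
      lw : ∀ i → lookup (lift w) i ≡ ι (lookup w i)
      lw = lookup∘tabulate (ι ∘ lookup w)
      hits : ∀ i a → does (lookup w i ≟ a) ≡ does (lookup (lift w) i ≟ ι a)
      hits i a = trans (≟-ι (lookup w i) a) (cong (λ y → does (y ≟ ι a)) (sym (lw i)))
      misses : ∀ z → π z ≡ nothing → ∀ i → does (lookup (lift w) i ≟ z) ≡ false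
      misses z e i = subst (λ y → does (y ≟ z) ≡ false) (sym (lw i)) (≟-outside z e (lookup w i))
      vertices : ∀ z → sel (lookup (proj₁ (image K G w))) z ≡ vertexᵇ (lift w) z
      vertices z with π z in eq
      ... | just a rewrite sym (ι-π z a eq) =
        trans (lookup∘tabulate _ a) (any-cong _ _ (allFin (n K)) (λ i → hits i a))
      ... | nothing = sym (any-false _ (allFin (n K)) (misses z eq))
      edges′ : ∀ z z′ → sel (λ a → sel (λ a′ → lookup (lookup (proj₂ (image K G w)) a) a′) z′) z ≡ edgeᵇ K (lift w) z z′
      edges′ z z′ with π z in eq | π z′ in eq′
      ... | just a | just a′ rewrite sym (ι-π z a eq) | sym (ι-π z′ a′ eq′)
            | lookup∘tabulate (λ u → tabulate (λ v → edgeᵇ K w u v)) a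
            | lookup∘tabulate (edgeᵇ K w a) a′ =
        any-cong _ _ (allFin (n K)) (λ i → any-cong _ _ (allFin (n K)) (λ j →
          cong₂ (λ x y → x ∧ y ∧ adj K i j) (hits i a) (hits j a′)))
      ... | just a | nothing = sym (any-false _ (allFin (n K)) (λ i → any-false _ (allFin (n K)) (λ j →
          subst (λ b → does (lookup (lift w) i ≟ z) ∧ b ∧ adj K i j ≡ false) (sym (misses z′ eq′ j))
            (BoolP.∧-zeroʳ (does (lookup (lift w) i ≟ z))))))
      ... | nothing | _ = sym (any-false _ (allFin (n K)) (λ i → any-false _ (allFin (n K)) (λ j →
          subst (λ b → b ∧ does (lookup (lift w) j ≟ z′) ∧ adj K i j ≡ false) (sym (misses z eq i)) refl)))

    lift-emb : ∀ K w → Emb K G (lookup w) → Emb K G′ (lookup (lift w))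
    lift-emb K w (w-inj , w-hom) =
      (λ i j e → w-inj i j (ι-inj _ _ (trans (sym (lookup∘tabulate _ i)) (trans e (lookup∘tabulate _ j))))) ,
      (λ i j a → trans (cong₂ (adj G′) (lookup∘tabulate _ i) (lookup∘tabulate _ j)) (trans (adj-ι _ _) (w-hom i j a)))

    T-images⊆ : ∀ K s → s ∈ map T (images K G) → s ∈ images K G′
    T-images⊆ K s m with ∈-map⁻ T m
    ... | s₀ , m₀ , refl with images⁻ K G m₀
    ... | w , e , refl = subst (_∈ images K G′) (sym (T-image K w)) (images⁺ K G′ (lift w) (lift-emb K w e))

    -- An embedding of a connected K that meets the range of ι stays in
    -- it, because the range is closed under adjacency.
    lower : ∀ K → Connected K → ∀ v → Emb K G′ (lookup v) → ∀ i₀ a₀ → π (lookup v i₀) ≡ just a₀ →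
            ∃[ w ] (Emb K G (lookup w) × image K G′ v ≡ T (image K G w))
    lower K (_ , conn) v (v-inj , v-hom) i₀ a₀ e₀ =
      w , (w-inj , w-hom) , trans (cong (image K G′) v≡lift) (sym (T-image K w))
      where
      reach : ∀ {i j} → Walk K i j → ∃[ a ] π (lookup v i) ≡ just a → ∃[ a ] π (lookup v j) ≡ just a
      reach here         p       = p
      reach (step ad wk) (a , p) = reach wk (closed _ _ a p (v-hom _ _ ad))
      inside : ∀ i → ∃[ a ] π (lookup v i) ≡ just a
      inside i = reach (conn i₀ i) (a₀ , e₀)
      w : Vec (Fin (n G)) (n K)
      w = tabulate (λ i → proj₁ (inside i))
      lw : ∀ i → ι (lookup w i) ≡ lookup v i
      lw i = trans (cong ι (lookup∘tabulate _ i)) (ι-π _ _ (proj₂ (inside i)))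
      v≡lift : v ≡ lift w
      v≡lift = vec-ext v (lift w) (λ i → trans (sym (lw i)) (sym (lookup∘tabulate _ i)))
      w-inj : Inj (lookup w)
      w-inj i j e = v-inj i j (trans (sym (lw i)) (trans (cong ι e) (lw j)))
      w-hom : Hom K G (lookup w)
      w-hom i j ad = trans (sym (adj-ι _ _)) (trans (cong₂ (adj G′) (lw i) (lw j)) (v-hom i j ad))

  -- Disjoint unions.  Both summands are closed inclusions into
  -- G₁ ⊎ᴳ G₂, so a connected K lies in exactly one of them; hence
  -- K(G₁ ⊎ G₂) = K(G₁) + K(G₂) for connected K.

  module Union (G₁ G₂ : Graph) where
    n₁ n₂ : ℕ
    n₁ = n G₁
    n₂ = n G₂
    U : Graph
    U = G₁ ⊎ᴳ G₂

    π₁ : Fin (n₁ + n₂) → Maybe (Fin n₁)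
    π₁ z = [ just , (λ _ → nothing) ]′ (splitAt n₁ z)
    π₂ : Fin (n₁ + n₂) → Maybe (Fin n₂)
    π₂ z = [ (λ _ → nothing) , just ]′ (splitAt n₁ z)
    ι₁ : Fin n₁ → Fin (n₁ + n₂)
    ι₁ a = a ↑ˡ n₂
    ι₂ : Fin n₂ → Fin (n₁ + n₂)
    ι₂ a = n₁ ↑ʳ a

    π₁-ι₁ : ∀ a → π₁ (ι₁ a) ≡ just a
    π₁-ι₁ a rewrite FinP.splitAt-↑ˡ n₁ a n₂ = refl
    π₂-ι₂ : ∀ a → π₂ (ι₂ a) ≡ just a
    π₂-ι₂ a rewrite FinP.splitAt-↑ʳ n₁ n₂ a = refl

    ι₁-π₁ : ∀ z a → π₁ z ≡ just a → ι₁ a ≡ z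
    ι₁-π₁ z a e with splitAt n₁ z in eq
    ι₁-π₁ z a refl | inj₁ .a = trans (cong (join n₁ n₂) (sym eq)) (FinP.join-splitAt n₁ n₂ z)
    ι₂-π₂ : ∀ z a → π₂ z ≡ just a → ι₂ a ≡ z
    ι₂-π₂ z a e with splitAt n₁ z in eq
    ι₂-π₂ z a refl | inj₂ .a = trans (cong (join n₁ n₂) (sym eq)) (FinP.join-splitAt n₁ n₂ z)

    uadj : Fin n₁ ⊎ Fin n₂ → Fin n₁ ⊎ Fin n₂ → Bool
    uadj (inj₁ x) (inj₁ y) = adj G₁ x y
    uadj (inj₂ x) (inj₂ y) = adj G₂ x y
    uadj (inj₁ x) (inj₂ y) = false
    uadj (inj₂ x) (inj₁ y) = false

    adj-⊎ : ∀ x y → adj U x y ≡ uadj (splitAt n₁ x) (splitAt n₁ y)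
    adj-⊎ x y with splitAt n₁ x | splitAt n₁ y
    ... | inj₁ a | inj₁ b = refl
    ... | inj₁ a | inj₂ b = refl
    ... | inj₂ a | inj₁ b = refl
    ... | inj₂ a | inj₂ b = refl

    adj-ι₁ : ∀ a b → adj U (ι₁ a) (ι₁ b) ≡ adj G₁ a b
    adj-ι₁ a b rewrite adj-⊎ (ι₁ a) (ι₁ b) | FinP.splitAt-↑ˡ n₁ a n₂ | FinP.splitAt-↑ˡ n₁ b n₂ = refl
    adj-ι₂ : ∀ a b → adj U (ι₂ a) (ι₂ b) ≡ adj G₂ a b
    adj-ι₂ a b rewrite adj-⊎ (ι₂ a) (ι₂ b) | FinP.splitAt-↑ʳ n₁ n₂ a | FinP.splitAt-↑ʳ n₁ n₂ b = refl

    closed₁ : ∀ z z′ a → π₁ z ≡ just a → adj U z z′ ≡ true → ∃[ a′ ] π₁ z′ ≡ just a′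
    closed₁ z z′ a e ad rewrite adj-⊎ z z′ with splitAt n₁ z | splitAt n₁ z′
    closed₁ z z′ a refl ad | inj₁ x | inj₁ y = y , refl
    closed₁ z z′ a refl () | inj₁ x | inj₂ y
    closed₂ : ∀ z z′ a → π₂ z ≡ just a → adj U z z′ ≡ true → ∃[ a′ ] π₂ z′ ≡ just a′
    closed₂ z z′ a e ad rewrite adj-⊎ z z′ with splitAt n₁ z | splitAt n₁ z′
    closed₂ z z′ a refl () | inj₂ x | inj₁ y
    closed₂ z z′ a refl ad | inj₂ x | inj₂ y = y , refl

    module S₁ = ClosedInclusion G₁ U ι₁ π₁ π₁-ι₁ ι₁-π₁ adj-ι₁ closed₁
    module S₂ = ClosedInclusion G₂ U ι₂ π₂ π₂-ι₂ ι₂-π₂ adj-ι₂ closed₂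

    outside₁ : ∀ z → π₁ z ≡ nothing → ∃[ a ] π₂ z ≡ just a
    outside₁ z e with splitAt n₁ z
    outside₁ z refl | inj₂ b = b , refl

    disjoint : ∀ K → 0 < n K → ∀ s → s ∈ map S₁.T (images K G₁) → s ∈ map S₂.T (images K G₂) → ⊥
    disjoint K nonempty s m₁ m₂ with ∈-map⁻ S₁.T m₁ | ∈-map⁻ S₂.T m₂
    ... | s₁ , m₁′ , refl | s₂ , m₂′ , eq with images⁻ K G₁ m₁′
    ... | w , _ , refl = true≢false (trans (sym in₁) (trans (cong (λ s → lookup (proj₁ s) (ι₁ x)) eq) out₂))
      where
      x : Fin n₁
      x = lookup w (fromℕ< nonempty)
      in₁ : lookup (proj₁ (S₁.T (image K G₁ w))) (ι₁ x) ≡ true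
      in₁ = trans (S₁.T-vertex (image K G₁ w) x)
                  (trans (lookup∘tabulate _ x) (vertexᵇ-complete w x (fromℕ< nonempty , refl)))
      out₂ : lookup (proj₁ (S₂.T s₂)) (ι₁ x) ≡ false
      out₂ rewrite lookup∘tabulate (S₂.sel (lookup (proj₁ s₂))) (ι₁ x) | FinP.splitAt-↑ˡ n₁ x n₂ = refl

    -- An image of a connected K in U lies in the summand containing the
    -- image of its first vertex.
    images-union : ∀ K → Connected K → ∀ s →
                   s ∈ images K U → s ∈ map S₁.T (images K G₁) ++ map S₂.T (images K G₂)
    images-union K c s m with images⁻ K U m
    ... | v , e , refl with π₁ (lookup v (fromℕ< (proj₁ c))) in eq
    ... | just a with S₁.lower K c v e _ a eq
    ... | w , e′ , im = ∈-++⁺ˡ (subst (_∈ map S₁.T (images K G₁)) (sym im) (∈-map⁺ S₁.T (images⁺ K G₁ w e′)))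
    images-union K c s m | v , e , refl | nothing with outside₁ _ eq
    ... | a , eq₂ with S₂.lower K c v e _ a eq₂
    ... | w , e′ , im = ∈-++⁺ʳ (map S₁.T (images K G₁))
                          (subst (_∈ map S₂.T (images K G₂)) (sym im) (∈-map⁺ S₂.T (images⁺ K G₂ w e′)))

    count-union : ∀ K → Connected K → count K U ≡ count K G₁ + count K G₂
    count-union K c = begin
      count K U
        ≡⟨ card-set _≟Sub_ (images K U) (T₁ ++ T₂) (images-union K c) both⊆ ⟩
      card _≟Sub_ (T₁ ++ T₂)
        ≡⟨ card-++ _≟Sub_ T₁ T₂ (disjoint K (proj₁ c)) ⟩
      card _≟Sub_ T₁ + card _≟Sub_ T₂
        ≡⟨ cong₂ _+_ (card-map _≟Sub_ _≟Sub_ S₁.T S₁.T-inj (images K G₁))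
                     (card-map _≟Sub_ _≟Sub_ S₂.T S₂.T-inj (images K G₂)) ⟩
      count K G₁ + count K G₂ ∎
      where
      T₁ T₂ : List (Subgraph (n₁ + n₂))
      T₁ = map S₁.T (images K G₁)
      T₂ = map S₂.T (images K G₂)
      both⊆ : ∀ s → s ∈ T₁ ++ T₂ → s ∈ images K U
      both⊆ s m with ∈-++⁻ T₁ m
      ... | inj₁ m₁ = S₁.T-images⊆ K s m₁
      ... | inj₂ m₂ = S₂.T-images⊆ K s m₂

  -- A Boolean predicate r on Fin n induces a bijection
  -- Fin n ≅ Fin m₁ ⊎ Fin m₂ sending the r-vertices left; applied part a
  -- component of a nonempty disconnected H this gives H ≅ A ⊎ᴳ B with
  -- A and B nonempty.

  record Partition {n} (r : Fin n → Bool) : Set where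
    field
      m₁ m₂   : ℕ
      part      : Fin n → Fin m₁ ⊎ Fin m₂
      unpart    : Fin m₁ ⊎ Fin m₂ → Fin n
      unpart-part : ∀ i → unpart (part i) ≡ i
      part-unpart : ∀ z → part (unpart z) ≡ z
      left    : ∀ x → r (unpart (inj₁ x)) ≡ true
      right   : ∀ y → r (unpart (inj₂ y)) ≡ false

  cons-left : ∀ {n} {r : Fin (suc n) → Bool} → r zero ≡ true → Partition (r ∘ suc) → Partition r
  cons-left {n} {r} r0 P = record
    { m₁ = suc P.m₁ ; m₂ = P.m₂ ; part = part ; unpart = unpart ; unpart-part = unpart-part
    ; part-unpart = part-unpart ; left = left ; right = P.right }
    where
    module P = Partition P
    part : Fin (suc n) → Fin (suc P.m₁) ⊎ Fin P.m₂
    part zero    = inj₁ zero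
    part (suc i) = [ (λ x → inj₁ (suc x)) , inj₂ ]′ (P.part i)
    unpart : Fin (suc P.m₁) ⊎ Fin P.m₂ → Fin (suc n)
    unpart (inj₁ zero)    = zero
    unpart (inj₁ (suc x)) = suc (P.unpart (inj₁ x))
    unpart (inj₂ y)       = suc (P.unpart (inj₂ y))
    unpart-part : ∀ i → unpart (part i) ≡ i
    unpart-part zero = refl
    unpart-part (suc i) with P.part i | P.unpart-part i
    ... | inj₁ x | e = cong suc e
    ... | inj₂ y | e = cong suc e
    part-unpart : ∀ z → part (unpart z) ≡ z
    part-unpart (inj₁ zero)    = refl
    part-unpart (inj₁ (suc x)) rewrite P.part-unpart (inj₁ x) = refl
    part-unpart (inj₂ y)       rewrite P.part-unpart (inj₂ y) = refl
    left : ∀ x → r (unpart (inj₁ x)) ≡ true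
    left zero    = r0
    left (suc x) = P.left x

  cons-right : ∀ {n} {r : Fin (suc n) → Bool} → r zero ≡ false → Partition (r ∘ suc) → Partition r
  cons-right {n} {r} r0 P = record
    { m₁ = P.m₁ ; m₂ = suc P.m₂ ; part = part ; unpart = unpart ; unpart-part = unpart-part
    ; part-unpart = part-unpart ; left = P.left ; right = right }
    where
    module P = Partition P
    part : Fin (suc n) → Fin P.m₁ ⊎ Fin (suc P.m₂)
    part zero    = inj₂ zero
    part (suc i) = [ inj₁ , (λ y → inj₂ (suc y)) ]′ (P.part i)
    unpart : Fin P.m₁ ⊎ Fin (suc P.m₂) → Fin (suc n)
    unpart (inj₂ zero)    = zero
    unpart (inj₂ (suc y)) = suc (P.unpart (inj₂ y))
    unpart (inj₁ x)       = suc (P.unpart (inj₁ x))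
    unpart-part : ∀ i → unpart (part i) ≡ i
    unpart-part zero = refl
    unpart-part (suc i) with P.part i | P.unpart-part i
    ... | inj₁ x | e = cong suc e
    ... | inj₂ y | e = cong suc e
    part-unpart : ∀ z → part (unpart z) ≡ z
    part-unpart (inj₂ zero)    = refl
    part-unpart (inj₂ (suc y)) rewrite P.part-unpart (inj₂ y) = refl
    part-unpart (inj₁ x)       rewrite P.part-unpart (inj₁ x) = refl
    right : ∀ y → r (unpart (inj₂ y)) ≡ false
    right zero    = r0
    right (suc y) = P.right y

  partition : ∀ {n} (r : Fin n → Bool) → Partition r
  partition {zero} r = record
    { m₁ = 0 ; m₂ = 0 ; part = λ () ; unpart = [ (λ ()) , (λ ()) ]′ ; unpart-part = λ ()
    ; part-unpart = λ { (inj₁ ()) ; (inj₂ ()) } ; left = λ () ; right = λ () }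
  partition {suc n} r with r zero in r0
  ... | true  = cons-left r0 (partition (r ∘ suc))
  ... | false = cons-right r0 (partition (r ∘ suc))

  module Cut (H : Graph) (r : Fin (n H) → Bool)
             (r-closed : ∀ i j → r i ≡ true → adj H i j ≡ true → r j ≡ true) where
    open Partition (partition r) public

    A B : Graph
    A = mkGraph m₁ (λ x y → adj H (unpart (inj₁ x)) (unpart (inj₁ y))) (λ x y → Graph.sym H _ _) (λ x → irref H _)
    B = mkGraph m₂ (λ x y → adj H (unpart (inj₂ x)) (unpart (inj₂ y))) (λ x y → Graph.sym H _ _) (λ x → irref H _)

    r-part : ∀ i → r i ≡ [ (λ _ → true) , (λ _ → false) ]′ (part i)
    r-part i with part i in eq
    ... | inj₁ x = trans (cong r (trans (sym (unpart-part i)) (cong unpart eq))) (left x)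
    ... | inj₂ y = trans (cong r (trans (sym (unpart-part i)) (cong unpart eq))) (right y)

    inside : ∀ i → r i ≡ true → ∃[ x ] part i ≡ inj₁ x
    inside i e with part i | r-part i
    ... | inj₁ x | _  = x , refl
    ... | inj₂ y | e′ = ⊥-elim (true≢false (trans (sym e) e′))

    outside : ∀ i → r i ≡ false → ∃[ y ] part i ≡ inj₂ y
    outside i e with part i | r-part i
    ... | inj₂ y | _  = y , refl
    ... | inj₁ x | e′ = ⊥-elim (true≢false (trans (sym e′) e))

    private module U = Union A B

    cross : ∀ x y → adj H (unpart (inj₁ x)) (unpart (inj₂ y)) ≡ false
    cross x y with adj H (unpart (inj₁ x)) (unpart (inj₂ y)) in eq
    ... | false = refl
    ... | true  = ⊥-elim (true≢false (trans (sym (r-closed _ _ (left x) eq)) (right y)))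

    adj-unpart : ∀ z w → adj H (unpart z) (unpart w) ≡ U.uadj z w
    adj-unpart (inj₁ x) (inj₁ y) = refl
    adj-unpart (inj₂ x) (inj₂ y) = refl
    adj-unpart (inj₁ x) (inj₂ y) = cross x y
    adj-unpart (inj₂ x) (inj₁ y) = trans (Graph.sym H _ _) (cross y x)

    iso : Iso H (A ⊎ᴳ B)
    iso = record
      { to = join m₁ m₂ ∘ part
      ; from = unpart ∘ splitAt m₁
      ; from-to = λ i → trans (cong unpart (FinP.splitAt-join m₁ m₂ (part i))) (unpart-part i)
      ; to-from = λ z → trans (cong (join m₁ m₂) (part-unpart (splitAt m₁ z))) (FinP.join-splitAt m₁ m₂ z)
      ; adj-to = λ i j → begin
          adj H i j                                    ≡⟨ cong₂ (adj H) (sym (unpart-part i)) (sym (unpart-part j)) ⟩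
          adj H (unpart (part i)) (unpart (part j))    ≡⟨ adj-unpart (part i) (part j) ⟩
          U.uadj (part i) (part j)                     ≡⟨ sym (cong₂ U.uadj (FinP.splitAt-join m₁ m₂ (part i))
                                                                            (FinP.splitAt-join m₁ m₂ (part j))) ⟩
          U.uadj (splitAt m₁ (join m₁ m₂ (part i))) (splitAt m₁ (join m₁ m₂ (part j)))
                                                       ≡⟨ sym (U.adj-⊎ (join m₁ m₂ (part i)) (join m₁ m₂ (part j))) ⟩
          adj (A ⊎ᴳ B) (join m₁ m₂ (part i)) (join m₁ m₂ (part j)) ∎ }

  record Split (H : Graph) : Set where
    field
      A B : Graph
      A⁺  : 0 < n A
      B⁺  : 0 < n B
      iso : Iso H (A ⊎ᴳ B)

  nonempty : ∀ {m} → Fin m → 0 < m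
  nonempty {suc m} _ = s≤s z≤n

  -- Opaque: only the Split interface is used, and unfolding the component
  -- computation during type checking is needlessly expensive.
  opaque
    split : ∀ H → ¬ Connected H → 0 < n H → Split H
    split H disconnected H⁺ with outside-component H disconnected H⁺
    ... | u , v , Rv = record
      { A = A ; B = B ; A⁺ = nonempty (proj₁ (inside u R-u)) ; B⁺ = nonempty (proj₁ (outside v Rv)) ; iso = iso }
      where
      open Component H u using (R; R-closed; R-u)
      open Cut H R R-closed

  K₀ : Graph
  K₀ = mkGraph 0 (λ ()) (λ ()) (λ ())

  Iso-empty : ∀ K H → n K ≡ 0 → n H ≡ 0 → Iso K H
  Iso-empty K H nK≡0 nH≡0 = record
    { to = λ i → ⊥-elim (no-vertex nK≡0 i) ; from = λ i → ⊥-elim (no-vertex nH≡0 i)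
    ; from-to = λ i → ⊥-elim (no-vertex nK≡0 i) ; to-from = λ i → ⊥-elim (no-vertex nH≡0 i)
    ; adj-to = λ i j → ⊥-elim (no-vertex nK≡0 i) }
    where
    no-vertex : ∀ {m} → m ≡ 0 → Fin m → ⊥
    no-vertex refl ()

  Smaller : Graph → Graph → Set
  Smaller K H = n K < n H ⊎ (n K ≡ n H × edges K < edges H)

  smaller-induction : ∀ {p} (P : Graph → Set p) → (∀ H → (∀ K → Smaller K H → P K) → P H) → ∀ H → P H
  smaller-induction P ind H = <-rec (λ N → ∀ H → n H ≡ N → P H) by-order (n H) H refl
    where
    by-order : ∀ N → (∀ {M} → M < N → ∀ H → n H ≡ M → P H) → ∀ H → n H ≡ N → P H
    by-order N smaller-order H nH≡N = <-rec (λ E → ∀ H → n H ≡ N → edges H ≡ E → P H) by-edges (edges H) H nH≡N refl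
      where
      by-edges : ∀ E → (∀ {E′} → E′ < E → ∀ H → n H ≡ N → edges H ≡ E′ → P H) → ∀ H → n H ≡ N → edges H ≡ E → P H
      by-edges E fewer-edges H nH≡N eH≡E = ind H below
        where
        below : ∀ K → Smaller K H → P K
        below K (inj₁ lt)        = smaller-order (subst (n K <_) nH≡N lt) K refl
        below K (inj₂ (eq , lt)) = fewer-edges (subst (edges K <_) eH≡E lt) K (trans eq nH≡N) refl

  no-emb-larger : ∀ K G (h : Fin (n K) → Fin (n G)) → n G < n K → ¬ Emb K G h
  no-emb-larger K G h lt (h-inj , _) = ℕP.<⇒≱ lt (inj-size h h-inj)

  count-union-absent : ∀ K G₁ G₂ → (∀ h → ¬ Emb K (G₁ ⊎ᴳ G₂) h) →
    count K (G₁ ⊎ᴳ G₂) ≡ 0 × count K G₁ ≡ 0 × count K G₂ ≡ 0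
  count-union-absent K G₁ G₂ absent =
    count-zero K (G₁ ⊎ᴳ G₂) (λ v → absent (lookup v)) ,
    count-zero K G₁ (λ v e → absent _ (S₁.lift-emb K v e)) ,
    count-zero K G₂ (λ v e → absent _ (S₂.lift-emb K v e))
    where open Union G₁ G₂

open Combinatorics

module Linear {c ℓ : Level} (R : CommutativeRing c ℓ) where

  open import Defs hiding (sym)
  open import Data.Nat as ℕ using (ℕ; zero; suc; _≤_; z≤n; s≤s)
  import Data.Nat.Properties as ℕP
  open import Data.Bool using (true; false; if_then_else_)
  open import Data.Product using (_×_; _,_)
  open import Data.Sum using (_⊎_; inj₁; inj₂)
  open import Data.List using ([]; _∷_; length)
  open import Data.List.Membership.Propositional using (_∈_)
  open import Data.List.Relation.Unary.Any using (here; there)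
  open import Function.Bundles using (mk⇔)
  import Relation.Binary.PropositionalEquality as Eq
  open Eq using (_≡_)
  open CommutativeRing R
  open import Relation.Binary.Reasoning.Setoid setoid
  import Algebra.Solver.CommutativeMonoid +-commutativeMonoid as CM
  open import Algebra.Properties.Group +-group using (x∙y⁻¹≈ε⇒x≈y; x≈y⇒x∙y⁻¹≈ε; ε⁻¹≈ε; ⁻¹-involutive)
  open import Algebra.Properties.AbelianGroup +-abelianGroup using (⁻¹-∙-comm)
  open import Algebra.Properties.Ring ring using (-‿distribʳ-*)

  [_] : ℕ → Carrier
  [ k ] = ℕ→R R k

  [+] : ∀ m k → [ m ℕ.+ k ] ≈ [ m ] + [ k ]
  [+] zero    k = sym (+-identityˡ _)
  [+] (suc m) k = trans (+-congˡ ([+] m k)) (sym (+-assoc _ _ _))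

  -‿+ : ∀ p q → - (p + q) ≈ - p + - q
  -‿+ p q = sym (⁻¹-∙-comm p q)

  -- ⟪ L , Φ ⟫ = Σ_{(K , a) ∈ L} a · Φ(K): the polynomial L applied to an
  -- arbitrary graph invariant Φ in place of the counts K(G).
  ⟪_,_⟫ : GraphPoly R → (Graph → Carrier) → Carrier
  ⟪ []          , Φ ⟫ = 0#
  ⟪ (K , a) ∷ L , Φ ⟫ = a * Φ K + ⟪ L , Φ ⟫

  -- Additivity is the vanishing of ⟪ L , defect G₁ G₂ ⟫, where the
  -- defect of K is K(G₁ ⊎ G₂) − (K(G₁) + K(G₂)).

  defect : Graph → Graph → Graph → Carrier
  defect G₁ G₂ K = [ count K (G₁ ⊎ᴳ G₂) ] + - ([ count K G₁ ] + [ count K G₂ ])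

  defect-step : ∀ a x y z e e₁ e₂ →
    (a * x + e) + - ((a * y + e₁) + (a * z + e₂)) ≈ a * (x + - (y + z)) + (e + - (e₁ + e₂))
  defect-step a x y z e e₁ e₂ = begin
    (a * x + e) + - ((a * y + e₁) + (a * z + e₂))
      ≈⟨ +-congˡ (trans (-‿+ _ _) (+-cong (-‿+ _ _) (-‿+ _ _))) ⟩
    (a * x + e) + ((- (a * y) + - e₁) + (- (a * z) + - e₂))
      ≈⟨ CM.solve 6 (λ p q r s t u → ((p CM.⊕ q) CM.⊕ ((r CM.⊕ s) CM.⊕ (t CM.⊕ u))) CM.⊜
                                      ((p CM.⊕ (r CM.⊕ t)) CM.⊕ (q CM.⊕ (s CM.⊕ u)))) refl
           (a * x) e (- (a * y)) (- e₁) (- (a * z)) (- e₂) ⟩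
    (a * x + (- (a * y) + - (a * z))) + (e + (- e₁ + - e₂))
      ≈⟨ +-cong factor (+-congˡ (sym (-‿+ e₁ e₂))) ⟩
    a * (x + - (y + z)) + (e + - (e₁ + e₂)) ∎
    where
    factor : a * x + (- (a * y) + - (a * z)) ≈ a * (x + - (y + z))
    factor = begin
      a * x + (- (a * y) + - (a * z)) ≈⟨ +-congˡ (sym (-‿+ _ _)) ⟩
      a * x + - (a * y + a * z)       ≈⟨ +-congˡ (-‿cong (sym (distribˡ a y z))) ⟩
      a * x + - (a * (y + z))         ≈⟨ +-congˡ (-‿distribʳ-* a (y + z)) ⟩
      a * x + a * - (y + z)           ≈⟨ sym (distribˡ a x (- (y + z))) ⟩
      a * (x + - (y + z))             ∎

  eval-defect : ∀ L G₁ G₂ → eval R L (G₁ ⊎ᴳ G₂) + - (eval R L G₁ + eval R L G₂) ≈ ⟪ L , defect G₁ G₂ ⟫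
  eval-defect []            G₁ G₂ = trans (+-identityˡ _) (trans (-‿cong (+-identityˡ _)) ε⁻¹≈ε)
  eval-defect ((K , a) ∷ L) G₁ G₂ = trans (defect-step a _ _ _ _ _ _) (+-congˡ (eval-defect L G₁ G₂))

  additive⇔defect : ∀ L → Additive R L ⇔ (∀ G₁ G₂ → ⟪ L , defect G₁ G₂ ⟫ ≈ 0#)
  additive⇔defect L = mk⇔
    (λ add G₁ G₂ → trans (sym (eval-defect L G₁ G₂)) (x≈y⇒x∙y⁻¹≈ε (add G₁ G₂)))
    (λ vanish G₁ G₂ → x∙y⁻¹≈ε⇒x≈y _ _ (trans (eval-defect L G₁ G₂) (vanish G₁ G₂)))

  defect-iso : ∀ G₁ G₂ K K′ → isoᵇ K K′ ≡ true → defect G₁ G₂ K ≈ defect G₁ G₂ K′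
  defect-iso G₁ G₂ K K′ e = reflexive (Eq.cong₂ (λ x y → [ x ] + - y) (count-iso (G₁ ⊎ᴳ G₂) I)
      (Eq.cong₂ (λ x y → [ x ] + [ y ]) (count-iso G₁ I) (count-iso G₂ I)))
    where
    I : Iso K K′
    I = isoᵇ-sound K K′ e

  defect-connected : ∀ G₁ G₂ K → Connected K → defect G₁ G₂ K ≈ 0#
  defect-connected G₁ G₂ K K-conn = trans
    (+-congʳ (trans (reflexive (Eq.cong [_] (Union.count-union G₁ G₂ K K-conn))) ([+] (count K G₁) (count K G₂))))
    (-‿inverseʳ _)

  defect-of-counts : ∀ G₁ G₂ K {x y z} → count K (G₁ ⊎ᴳ G₂) ≡ x → count K G₁ ≡ y → count K G₂ ≡ z →
                     defect G₁ G₂ K ≡ [ x ] + - ([ y ] + [ z ])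
  defect-of-counts G₁ G₂ K Eq.refl Eq.refl Eq.refl = Eq.refl

  defect-absent : ∀ G₁ G₂ K → (∀ h → ¬ Emb K (G₁ ⊎ᴳ G₂) h) → defect G₁ G₂ K ≈ 0#
  defect-absent G₁ G₂ K absent with count-union-absent K G₁ G₂ absent
  ... | c₀ , c₁ , c₂ = begin
    defect G₁ G₂ K     ≡⟨ defect-of-counts G₁ G₂ K c₀ c₁ c₂ ⟩
    0# + - (0# + 0#)   ≈⟨ +-identityˡ _ ⟩
    - (0# + 0#)        ≈⟨ -‿cong (+-identityˡ _) ⟩
    - 0#               ≈⟨ ε⁻¹≈ε ⟩
    0#                 ∎

  module Grouping (Φ : Graph → Carrier) (Φ-iso : ∀ K K′ → isoᵇ K K′ ≡ true → Φ K ≈ Φ K′) where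

    without : Graph → GraphPoly R → GraphPoly R
    without K₀ [] = []
    without K₀ ((K , a) ∷ L) = if isoᵇ K K₀ then without K₀ L else (K , a) ∷ without K₀ L

    ⟪⟫-without : ∀ K₀ L → ⟪ L , Φ ⟫ ≈ coeff R L K₀ * Φ K₀ + ⟪ without K₀ L , Φ ⟫
    ⟪⟫-without K₀ [] = sym (trans (+-identityʳ _) (zeroˡ _))
    ⟪⟫-without K₀ ((K , a) ∷ L) with isoᵇ K K₀ in eq
    ... | true = begin
      a * Φ K + ⟪ L , Φ ⟫
        ≈⟨ +-cong (*-congˡ (Φ-iso K K₀ eq)) (⟪⟫-without K₀ L) ⟩
      a * Φ K₀ + (coeff R L K₀ * Φ K₀ + ⟪ without K₀ L , Φ ⟫)
        ≈⟨ sym (+-assoc _ _ _) ⟩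
      (a * Φ K₀ + coeff R L K₀ * Φ K₀) + ⟪ without K₀ L , Φ ⟫
        ≈⟨ +-congʳ (sym (distribʳ _ _ _)) ⟩
      (a + coeff R L K₀) * Φ K₀ + ⟪ without K₀ L , Φ ⟫ ∎
    ... | false = begin
      a * Φ K + ⟪ L , Φ ⟫
        ≈⟨ +-congˡ (⟪⟫-without K₀ L) ⟩
      a * Φ K + (coeff R L K₀ * Φ K₀ + ⟪ without K₀ L , Φ ⟫)
        ≈⟨ CM.solve 3 (λ p q r → (p CM.⊕ (q CM.⊕ r)) CM.⊜ (q CM.⊕ (p CM.⊕ r))) refl _ _ _ ⟩
      coeff R L K₀ * Φ K₀ + (a * Φ K + ⟪ without K₀ L , Φ ⟫)
        ≈⟨ +-congʳ (*-congʳ (sym (+-identityˡ _))) ⟩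
      (0# + coeff R L K₀) * Φ K₀ + (a * Φ K + ⟪ without K₀ L , Φ ⟫) ∎

    coeff-without : ∀ K₀ K L → isoᵇ K K₀ ≡ false → coeff R (without K₀ L) K ≈ coeff R L K
    coeff-without K₀ K [] e = refl
    coeff-without K₀ K ((K′ , a′) ∷ L) e with isoᵇ K′ K₀ in e₀
    ... | false = +-congˡ (coeff-without K₀ K L e)
    ... | true with isoᵇ K′ K in e₁
    ...   | false = trans (coeff-without K₀ K L e) (sym (+-identityˡ _))
    ...   | true with Eq.trans (Eq.sym (isoᵇ-trans K K′ K₀ (isoᵇ-sym K′ K e₁) e₀)) e
    ...     | ()

    ∈-without : ∀ K₀ L {K a} → (K , a) ∈ without K₀ L → (K , a) ∈ L × isoᵇ K K₀ ≡ false
    ∈-without K₀ ((K′ , a′) ∷ L) m with isoᵇ K′ K₀ in e₀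
    ... | true = let (p , q) = ∈-without K₀ L m in there p , q
    ∈-without K₀ ((K′ , a′) ∷ L) (here Eq.refl) | false = here Eq.refl , e₀
    ∈-without K₀ ((K′ , a′) ∷ L) (there m)      | false = let (p , q) = ∈-without K₀ L m in there p , q

    length-without : ∀ K₀ L → length (without K₀ L) ≤ length L
    length-without K₀ [] = z≤n
    length-without K₀ ((K′ , a′) ∷ L) with isoᵇ K′ K₀
    ... | true  = ℕP.m≤n⇒m≤1+n (length-without K₀ L)
    ... | false = s≤s (length-without K₀ L)

    without-head : ∀ K₀ a₀ L → without K₀ ((K₀ , a₀) ∷ L) ≡ without K₀ L
    without-head K₀ a₀ L rewrite isoᵇ-refl K₀ = Eq.refl

    Negligible : GraphPoly R → Graph → Set ℓ
    Negligible L K = Φ K ≈ 0# ⊎ coeff R L K ≈ 0#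

    negligible-without : ∀ K₀ L → (∀ K a → (K , a) ∈ L → isoᵇ K K₀ ≡ false → Negligible L K) →
                         ∀ K a → (K , a) ∈ without K₀ L → Negligible (without K₀ L) K
    negligible-without K₀ L neg K a m with ∈-without K₀ L m
    ... | m′ , K≇K₀ with neg K a m′ K≇K₀
    ... | inj₁ ΦK≈0 = inj₁ ΦK≈0
    ... | inj₂ cK≈0 = inj₂ (trans (coeff-without K₀ K L K≇K₀) cK≈0)

    -- Induction on a bound for the length of L, removing one isomorphism
    -- class at a time.
    ⟪⟫-vanish-bounded : ∀ fuel L → length L ≤ fuel → (∀ K a → (K , a) ∈ L → Negligible L K) → ⟪ L , Φ ⟫ ≈ 0#
    ⟪⟫-vanish-bounded fuel [] le neg = refl
    ⟪⟫-vanish-bounded (suc fuel) ((K₀ , a₀) ∷ L′) (s≤s le) neg = begin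
      ⟪ L , Φ ⟫                                    ≈⟨ ⟪⟫-without K₀ L ⟩
      coeff R L K₀ * Φ K₀ + ⟪ without K₀ L , Φ ⟫   ≈⟨ +-cong head≈0 rest≈0 ⟩
      0# + 0#                                      ≈⟨ +-identityˡ 0# ⟩
      0#                                           ∎
      where
      L : GraphPoly R
      L = (K₀ , a₀) ∷ L′
      head≈0 : coeff R L K₀ * Φ K₀ ≈ 0#
      head≈0 with neg K₀ a₀ (here Eq.refl)
      ... | inj₁ ΦK₀≈0 = trans (*-congˡ ΦK₀≈0) (zeroʳ _)
      ... | inj₂ cK₀≈0 = trans (*-congʳ cK₀≈0) (zeroˡ _)
      shorter : length (without K₀ L) ≤ fuel
      shorter = Eq.subst (λ X → length X ≤ fuel) (Eq.sym (without-head K₀ a₀ L′))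
                         (ℕP.≤-trans (length-without K₀ L′) le)
      rest≈0 : ⟪ without K₀ L , Φ ⟫ ≈ 0#
      rest≈0 = ⟪⟫-vanish-bounded fuel (without K₀ L) shorter (negligible-without K₀ L (λ K a m _ → neg K a m))

    ⟪⟫-vanish : ∀ L → (∀ K a → (K , a) ∈ L → Negligible L K) → ⟪ L , Φ ⟫ ≈ 0#
    ⟪⟫-vanish L = ⟪⟫-vanish-bounded (length L) L ℕP.≤-refl

    ⟪⟫-single : ∀ H L → (∀ K a → (K , a) ∈ L → isoᵇ K H ≡ false → Negligible L K) →
                ⟪ L , Φ ⟫ ≈ coeff R L H * Φ H
    ⟪⟫-single H L hyp = begin
      ⟪ L , Φ ⟫                                   ≈⟨ ⟪⟫-without H L ⟩
      coeff R L H * Φ H + ⟪ without H L , Φ ⟫     ≈⟨ +-congˡ rest≈0 ⟩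
      coeff R L H * Φ H + 0#                      ≈⟨ +-identityʳ _ ⟩
      coeff R L H * Φ H                           ∎
      where
      rest≈0 : ⟪ without H L , Φ ⟫ ≈ 0#
      rest≈0 = ⟪⟫-vanish (without H L) (negligible-without H L hyp)

  -- The two values the defect takes on the graph whose coefficient is
  -- extracted, 1 − (0 + 0) and 1 − (1 + 1), are units.

  [1]≈1 : [ 1 ] ≈ 1#
  [1]≈1 = +-identityʳ 1#

  unit-one : ∀ x → x * ([ 1 ] + - ([ 0 ] + [ 0 ])) ≈ 0# → x ≈ 0#
  unit-one x e = begin
    x                                 ≈⟨ sym (*-identityʳ x) ⟩
    x * 1#                            ≈⟨ *-congˡ (sym one) ⟩
    x * ([ 1 ] + - ([ 0 ] + [ 0 ]))   ≈⟨ e ⟩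
    0#                                ∎
    where
    one : [ 1 ] + - ([ 0 ] + [ 0 ]) ≈ 1#
    one = trans (+-cong [1]≈1 (trans (-‿cong (+-identityˡ 0#)) ε⁻¹≈ε)) (+-identityʳ 1#)

  unit-minus-one : ∀ x → x * ([ 1 ] + - ([ 1 ] + [ 1 ])) ≈ 0# → x ≈ 0#
  unit-minus-one x e = begin
    x                                   ≈⟨ sym (⁻¹-involutive x) ⟩
    - - x                               ≈⟨ -‿cong (sym times-minus-one) ⟩
    - (x * ([ 1 ] + - ([ 1 ] + [ 1 ]))) ≈⟨ -‿cong e ⟩
    - 0#                                ≈⟨ ε⁻¹≈ε ⟩
    0#                                  ∎
    where
    minus-one : [ 1 ] + - ([ 1 ] + [ 1 ]) ≈ - 1#
    minus-one = begin
      [ 1 ] + - ([ 1 ] + [ 1 ])     ≈⟨ +-congˡ (-‿+ [ 1 ] [ 1 ]) ⟩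
      [ 1 ] + (- [ 1 ] + - [ 1 ])   ≈⟨ sym (+-assoc _ _ _) ⟩
      ([ 1 ] + - [ 1 ]) + - [ 1 ]   ≈⟨ +-congʳ (-‿inverseʳ [ 1 ]) ⟩
      0# + - [ 1 ]                  ≈⟨ +-identityˡ _ ⟩
      - [ 1 ]                       ≈⟨ -‿cong [1]≈1 ⟩
      - 1#                          ∎
    times-minus-one : x * ([ 1 ] + - ([ 1 ] + [ 1 ])) ≈ - x
    times-minus-one = begin
      x * ([ 1 ] + - ([ 1 ] + [ 1 ]))   ≈⟨ *-congˡ minus-one ⟩
      x * - 1#                          ≈⟨ sym (-‿distribʳ-* x 1#) ⟩
      - (x * 1#)                        ≈⟨ -‿cong (*-identityʳ x) ⟩
      - x                               ∎

module Theorem {c ℓ : Level} (R : CommutativeRing c ℓ) (L : GraphPoly R) where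

  open import Defs hiding (sym)
  open import Data.Bool using (false)
  import Data.Nat as ℕ
  import Data.Nat.Properties as ℕP
  open import Data.Product using (_,_)
  open import Data.Sum using (inj₁; inj₂)
  open import Data.List.Membership.Propositional using (_∈_)
  open import Data.Vec using (lookup)
  open import Data.Empty using (⊥-elim)
  open import Relation.Nullary using (yes; no)
  open import Relation.Binary.Definitions using (tri<; tri≈; tri>)
  open import Function using (_∘_)
  open import Function.Bundles using (Equivalence)
  import Relation.Binary.PropositionalEquality as Eq
  open Eq using (_≡_)
  open CommutativeRing R
  open Linear R

  module ByDefect (G₁ G₂ : Graph) = Grouping (defect G₁ G₂) (defect-iso G₁ G₂)

  OthersNegligible : Graph → Graph → Graph → Set (c Level.⊔ ℓ)
  OthersNegligible G₁ G₂ H =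
    ∀ K a → (K , a) ∈ L → isoᵇ K H ≡ false → ByDefect.Negligible G₁ G₂ L K

  coefficients⇒additive : (∀ H → ¬ Connected H → coeff R L H ≈ 0#) → Additive R L
  coefficients⇒additive vanish = Equivalence.from (additive⇔defect L) λ G₁ G₂ →
    ByDefect.⟪⟫-vanish G₁ G₂ L (λ K _ _ → negligible G₁ G₂ K)
    where
    negligible : ∀ G₁ G₂ K → ByDefect.Negligible G₁ G₂ L K
    negligible G₁ G₂ K with connected? K
    ... | yes K-conn = inj₁ (defect-connected G₁ G₂ K K-conn)
    ... | no K-disc  = inj₂ (vanish K K-disc)

  module _ (additive : Additive R L) where

    isolate : ∀ G₁ G₂ H → OthersNegligible G₁ G₂ H → coeff R L H * defect G₁ G₂ H ≈ 0#
    isolate G₁ G₂ H others = trans (sym (ByDefect.⟪⟫-single G₁ G₂ H L others))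
                                   (Equivalence.to (additive⇔defect L) additive G₁ G₂)

    -- The empty graph: compare K₀ ⊎ K₀ with K₀ and K₀; H occurs once in
    -- each, and every nonempty graph is absent.
    empty-coefficient : ∀ H → n H ≡ 0 → coeff R L H ≈ 0#
    empty-coefficient H nH≡0 = unit-minus-one _ (trans (*-congˡ (reflexive (Eq.sym defect-H))) (isolate K₀ K₀ H others))
      where
      once : ∀ G → n G ≡ 0 → count H G ≡ 1
      once G nG≡0 = Eq.trans (count-iso G (Iso-empty H G nH≡0 nG≡0)) (count-self G)
      defect-H : defect K₀ K₀ H ≡ [ 1 ] + - ([ 1 ] + [ 1 ])
      defect-H = defect-of-counts K₀ K₀ H (once (K₀ ⊎ᴳ K₀) Eq.refl) (once K₀ Eq.refl) (once K₀ Eq.refl)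
      others : OthersNegligible K₀ K₀ H
      others K a _ K≇H with n K ℕ.≟ 0
      ... | yes nK≡0 = ⊥-elim (isoᵇ-false K≇H (Iso-empty K H nK≡0 nH≡0))
      ... | no nK≢0  = inj₁ (defect-absent K₀ K₀ K (λ h → no-emb-larger K (K₀ ⊎ᴳ K₀) h (ℕP.n≢0⇒n>0 nK≢0)))

    -- A nonempty disconnected H ≅ A ⊎ B: H occurs once in A ⊎ B and not
    -- in A or B; any other disconnected K is either smaller than H (and
    -- handled by induction) or absent from H.
    split-coefficient : ∀ H → (∀ K → Smaller K H → ¬ Connected K → coeff R L K ≈ 0#) →
                        ¬ Connected H → 0 ℕ.< n H → coeff R L H ≈ 0#
    split-coefficient H smaller H-disc H⁺ = unit-one _ (trans (*-congˡ (reflexive (Eq.sym defect-H))) (isolate A B H others))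
      where
      open Split (split H H-disc H⁺)
      nH≡ : n H ≡ n A ℕ.+ n B
      nH≡ = Iso-n iso
      defect-H : defect A B H ≡ [ 1 ] + - ([ 0 ] + [ 0 ])
      defect-H = defect-of-counts A B H (Eq.trans (count-iso (A ⊎ᴳ B) iso) (count-self (A ⊎ᴳ B)))
        (count-zero H A (λ v → no-emb-larger H A (lookup v) (Eq.subst (n A ℕ.<_) (Eq.sym nH≡) (ℕP.m<m+n (n A) B⁺))))
        (count-zero H B (λ v → no-emb-larger H B (lookup v) (Eq.subst (n B ℕ.<_) (Eq.sym nH≡) (ℕP.m<n+m (n B) A⁺))))
      absent-from-H : ∀ K → (∀ h → ¬ Emb K H h) → defect A B K ≈ 0#
      absent-from-H K absent = defect-absent A B K (λ h e → absent (Iso.to iso⁻¹ ∘ h) (Emb-Iso {K = K} h e iso⁻¹))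
        where
        iso⁻¹ : Iso (A ⊎ᴳ B) H
        iso⁻¹ = Iso-sym iso
      others : OthersNegligible A B H
      others K a _ K≇H with connected? K
      ... | yes K-conn = inj₁ (defect-connected A B K K-conn)
      ... | no K-disc with ℕP.<-cmp (n K) (n H)
      ...   | tri< lt _ _ = inj₂ (smaller K (inj₁ lt) K-disc)
      ...   | tri> _ _ gt = inj₁ (absent-from-H K (λ h → no-emb-larger K H h gt))
      ...   | tri≈ _ eq _ with edges K ℕ.<? edges H
      ...     | yes lt = inj₂ (smaller K (inj₂ (eq , lt)) K-disc)
      ...     | no ≮   = inj₁ (absent-from-H K (λ h e → isoᵇ-false K≇H (emb-iso K H h e eq (ℕP.≮⇒≥ ≮))))

    additive⇒coefficients : ∀ H → ¬ Connected H → coeff R L H ≈ 0#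
    additive⇒coefficients = smaller-induction (λ H → ¬ Connected H → coeff R L H ≈ 0#) by-cases
      where
      by-cases : ∀ H → (∀ K → Smaller K H → ¬ Connected K → coeff R L K ≈ 0#) → ¬ Connected H → coeff R L H ≈ 0#
      by-cases H smaller H-disc with n H ℕ.≟ 0
      ... | yes nH≡0 = empty-coefficient H nH≡0
      ... | no nH≢0  = split-coefficient H smaller H-disc (ℕP.n≢0⇒n>0 nH≢0)

lemma4p2 : {c ℓ : Level} (R : CommutativeRing c ℓ) (L : GraphPoly R) →
    Additive R L ⇔ (∀ H → ¬ Connected H → CommutativeRing._≈_ R (coeff R L H) (CommutativeRing.0# R))
lemma4p2 R L = mk⇔ (Theorem.additive⇒coefficients R L) (Theorem.coefficients⇒additive R L)
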